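{- Let $p$ be an odd prime and $t\in\mathbb{N}$ with $1\le t\le p-1$. Let $y_1,\dots,y_{2t}\in\mathbb{Z}_p$, let $f_1=\sum_{j=1}^t a_{j1}x^{\alpha_{j1}}\in\mathbb{Z}[x]$, and let $x_1=\overline{(x_{1k})}_k,\dots,x_{2t}=\overline{(x_{(2t)k})}_k\in\mathbb{Z}_p^\times$ satisfy: (i) $f_1(x_i)\equiv y_i\pmod p$ for $1\le i\le 2t$; (ii) $\det\begin{pmatrix} x_1^{\alpha_{11}}&\cdots&x_1^{\alpha_{t1}}& a_{11}e_2(x_{12})x_1^{\alpha_{11}}&\cdots& a_{t1}e_2(x_{12})x_1^{\alpha_{t1}}\\ \vdots&&\vdots&\vdots&&\vdots\\ x_{2t}^{\alpha_{11}}&\cdots&x_{2t}^{\alpha_{t1}}& a_{11}e_2(x_{(2t)2})x_{2t}^{\alpha_{11}}&\cdots& a_{t1}e_2(x_{(2t)2})x_{2t}^{\alpha_{t1}}\end{pmatrix}\not\equiv 0\pmod p$. Then there exists a unique $f=\sum_{j=1}^t a_jx^{\alpha_j}$ with $a_j\in\mathbb{Z}_p^\times$ and $\alpha_j\in\mathcal{E}_p$ ($1\le j\le t$) such that simultaneously $f(x_i)=y_i$ in $\mathbb{Z}_p$ for $1\le i\le 2t$, and $a_j=\overline{(a_{j1},\dots)}$, $\alpha_j=\overline{(\alpha_{j1},\dots)}$ (i.e. $a_j$ has first coordinate $a_{j1}$ and $\alpha_j$ has first coordinate $\alpha_{j1}$) for $1\le j\le t$.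
   Context: $\mathbb{Z}_p$ is modeled as the set of sequences $(a_k)_{k\in\mathbb{N}}$ of integers with $a_{k+1}\equiv a_k\pmod{p^k}$, modulo $a_k\equiv b_k\pmod{p^k}$ for all $k$, coordinatewise operations; units: $p\nmid a_1$; congruences of elements of $\mathbb{Z}_p$ modulo $p$ refer to first coordinates. $\mathcal{E}_p$ is the set of sequences $(\alpha_k)_{k\in\mathbb{N}}$ of integers with $\alpha_{k+1}\equiv\alpha_k\pmod{\varphi(p^k)}$, modulo $\alpha_k\equiv\beta_k\pmod{\varphi(p^k)}$ for all $k$ ($\varphi$ = Euler's totient). For $a=\overline{(a_k)}\in\mathbb{Z}_p^\times$, $\alpha=\overline{(\alpha_k)}\in\mathcal{E}_p$, $a^\alpha:=\overline{(a_k^{\alpha_k})}$, and for $f=\sum_j a_jx^{\alpha_j}$ and $x\in\mathbb{Z}_p^\times$, $f(x)=\sum_ja_jx^{\alpha_j}\in\mathbb{Z}_p$; integers are embedded in $\mathbb{Z}_p$ and $\mathcal{E}_p$ as constant sequences. $e_2:(\mathbb{Z}/p^2\mathbb{Z})^\times\to\mathbb{Z}/p\mathbb{Z}$ is defined by $x^{p-1}\equiv1+p\,e_2(x)\pmod{p^2}$. -}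

module Defs where

open import Data.Nat as ℕ using (ℕ; zero; suc; _≤_)
open import Data.Integer as ℤ using (ℤ; +_; _-_; _*_; _^_; _+_)
open import Data.Integer.Divisibility using (_∣_)
open import Data.Nat.Coprimality using (coprime?)
open import Data.Fin as Fin using (Fin; splitAt; punchIn)
open import Data.Sum using (inj₁; inj₂)
open import Data.List using (length; filter)
open import Data.List.Base using (upTo; map)
open import Relation.Nullary using (¬_)

_≡_[mod_] : ℤ → ℤ → ℕ → Set
a ≡ b [mod m ] = (+ m) ∣ (a - b)

φ : ℕ → ℕ
φ n = length (filter (λ m → coprime? m n) (map suc (upTo n)))

-- ℤ_p: integer sequences (coordinates k ≥ 1; coordinate 0 is ignored)
-- with a_{k+1} ≡ a_k (mod p^k)
record Zp (p : ℕ) : Set where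
  constructor mkZp
  field
    seq    : ℕ → ℤ
    coh    : ∀ k → 1 ≤ k → seq (suc k) ≡ seq k [mod p ℕ.^ k ]
open Zp public

_≈Zp_ : ∀ {p} → Zp p → Zp p → Set
_≈Zp_ {p} a b = ∀ k → 1 ≤ k → seq a k ≡ seq b k [mod p ℕ.^ k ]

IsUnit : ∀ {p} → Zp p → Set
IsUnit {p} a = ¬ ((+ p) ∣ seq a 1)

record Ep (p : ℕ) : Set where
  constructor mkEp
  field
    eseq   : ℕ → ℕ
    ecoh   : ∀ k → 1 ≤ k → (+ eseq (suc k)) ≡ (+ eseq k) [mod φ (p ℕ.^ k) ]
open Ep public

_≈Ep_ : ∀ {p} → Ep p → Ep p → Set
_≈Ep_ {p} α β = ∀ k → 1 ≤ k → (+ eseq α k) ≡ (+ eseq β k) [mod φ (p ℕ.^ k) ]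

sumFin : (n : ℕ) → (Fin n → ℤ) → ℤ
sumFin zero    f = + 0
sumFin (suc n) f = f Fin.zero + sumFin n (λ i → f (Fin.suc i))

evalCoord : ∀ {p} (t : ℕ) → (Fin t → Zp p) → (Fin t → Ep p) → Zp p → ℕ → ℤ
evalCoord t a α x k = sumFin t (λ j → seq (a j) k * (seq x k ^ eseq (α j) k))

EvalEq : ∀ {p} (t : ℕ) → (Fin t → Zp p) → (Fin t → Ep p) → Zp p → Zp p → Set
EvalEq {p} t a α x y = ∀ k → 1 ≤ k → evalCoord t a α x k ≡ seq y k [mod p ℕ.^ k ]

-- e₂ : x^{p-1} ≡ 1 + p e₂(x) (mod p²); integer representative (x^{p-1} - 1)/p
e₂ : ℕ → ℤ → ℤ
e₂ zero    x = + 0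
e₂ p@(suc _) x = (x ^ (p ℕ.∸ 1) - + 1) ℤ./ℕ p

sign : ℕ → ℤ
sign zero = + 1
sign (suc n) = ℤ.- sign n

det : (n : ℕ) → (Fin n → Fin n → ℤ) → ℤ
det zero    M = + 1
det (suc n) M = sumFin (suc n) (λ j →
  sign (Fin.toℕ j) * M Fin.zero j * det n (λ r c → M (Fin.suc r) (punchIn j c)))

-- first coordinate of the matrix in hypothesis (ii):
-- row i: x_i^{α_{j1}} (j ≤ t) then a_{j1} e₂(x_{i2}) x_i^{α_{j1}} (j ≤ t)
matrix2p5 : (p t : ℕ) → (Fin t → ℤ) → (Fin t → ℕ) → (Fin (t ℕ.+ t) → Zp p)
          → Fin (t ℕ.+ t) → Fin (t ℕ.+ t) → ℤ
matrix2p5 p t a₁ α₁ x i c with splitAt t c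
... | inj₁ j = seq (x i) 1 ^ α₁ j
... | inj₂ j = a₁ j * e₂ p (seq (x i) 2) * (seq (x i) 1 ^ α₁ j)

open import Relation.Binary.PropositionalEquality using (refl; cong)
open import Data.Integer.Properties using (i≡j⇒i-j≡0)
import Data.Nat.Divisibility as ℕD

≡-refl[mod] : ∀ a m → a ≡ a [mod m ]
≡-refl[mod] a m rewrite i≡j⇒i-j≡0 {a} refl = m ℕD.∣0

constZp : ∀ {p} → ℤ → Zp p
constZp {p} a = mkZp (λ _ → a) (λ k _ → ≡-refl[mod] a (p ℕ.^ k))

constEp : ∀ {p} → ℕ → Ep p
constEp {p} n = mkEp (λ _ → n) (λ k _ → ≡-refl[mod] (+ n) (φ (p ℕ.^ k)))

module Submission where

-- The coefficients and exponents are lifted one p-adic digit at a time, as in Hensel's lemma. Suppose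
-- A_j, B_j solve the 2t equations modulo p^(k+1). Put A_j' = A_j + p^(k+1) u_j and B_j' = B_j + φ(p^(k+1)) w_j.
-- For odd p and a unit z, z^φ(p^(k+1)) ≡ 1 + p^(k+1) e₂(z) (mod p^(k+2)), by Fermat's little theorem and the
-- binomial theorem. Hence, modulo p^(k+2), the left-hand side of equation i changes by
-- p^(k+1) Σ_j (x_i^α_j u_j + a_j e₂(x_i) x_i^α_j w_j).
-- The corrections (u, w) are therefore the solutions modulo p of a linear system, and its matrix is the
-- matrix of hypothesis (ii). That determinant is a unit mod p, so by Cramer's rule the system is injective
-- modulo p, and hence bijective because (ℤ/p)^2t is finite. So the digits exist and are unique at every level.

open import Defs

module Congruence where

  open import Data.Nat.Base as ℕ using (ℕ; zero; suc; NonZero)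
  import Data.Nat.Properties as ℕ
  import Data.Nat.Divisibility as ℕ
  open import Data.Nat.Primality using (Prime; euclidsLemma)
  open import Data.Integer.Base as ℤ using (ℤ; +_; 0ℤ; _-_; _*_; _+_; -_; _^_; ∣_∣)
  import Data.Integer.Properties as ℤ
  import Data.Integer.DivMod as ℤ
  import Data.Integer.Divisibility as ℤ
  import Data.Integer.Divisibility.Signed as Signed
  open import Data.Integer.Tactic.RingSolver using (solve-∀)
  open import Data.Fin.Base as Fin using (Fin)
  open import Data.Product.Base using (∃; _,_)
  open import Data.Sum.Base using (_⊎_; inj₁; inj₂)
  open import Function.Base using (_∘_)
  open import Level using (0ℓ)
  open import Relation.Binary.Bundles using (Setoid)
  import Relation.Binary.Reasoning.Setoid as SetoidReasoning
  open import Relation.Binary.PropositionalEquality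
  open import Relation.Nullary.Negation using (contradiction)

  infix 4 _≋_[mod_]

  -- Congruence with an explicit quotient: unlike _≡_[mod_] (a divisibility of ∣ a - b ∣) it keeps a, b, m
  -- inferable, and congruence arithmetic becomes ring arithmetic on quotients.
  record _≋_[mod_] (a b : ℤ) (m : ℕ) : Set where
    constructor ≋-by
    field
      quotient : ℤ
      equation : a ≡ b + quotient * + m

  module _ {m : ℕ} where

    ≡⇒≋ : ∀ {a b} → a ≡ b → a ≋ b [mod m ]
    ≡⇒≋ {a} refl = ≋-by 0ℤ (a≡a+0*m a (+ m))
      where
      a≡a+0*m : ∀ a m → a ≡ a + 0ℤ * m
      a≡a+0*m = solve-∀

    ≋-refl : ∀ {a} → a ≋ a [mod m ]
    ≋-refl = ≡⇒≋ refl

    ≋-sym : ∀ {a b} → a ≋ b [mod m ] → b ≋ a [mod m ]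
    ≋-sym {b = b} (≋-by q refl) = ≋-by (- q) (b≡b+qm-qm b q (+ m))
      where
      b≡b+qm-qm : ∀ b q m → b ≡ b + q * m + - q * m
      b≡b+qm-qm = solve-∀

    ≋-trans : ∀ {a b c} → a ≋ b [mod m ] → b ≋ c [mod m ] → a ≋ c [mod m ]
    ≋-trans {c = c} (≋-by q refl) (≋-by q′ refl) = ≋-by (q′ + q) (collect c q q′ (+ m))
      where
      collect : ∀ c q q′ m → c + q′ * m + q * m ≡ c + (q′ + q) * m
      collect = solve-∀

    ≋-setoid : Setoid 0ℓ 0ℓ
    ≋-setoid = record
      { Carrier       = ℤ
      ; _≈_           = λ a b → a ≋ b [mod m ]
      ; isEquivalence = record { refl = ≋-refl ; sym = ≋-sym ; trans = ≋-trans }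
      }

    +-multiple≋ : ∀ a q → a + q * + m ≋ a [mod m ]
    +-multiple≋ a q = ≋-by q refl

    multiple≋0 : ∀ q → q * + m ≋ 0ℤ [mod m ]
    multiple≋0 q = ≋-by q (sym (ℤ.+-identityˡ (q * + m)))

    +-cong≋ : ∀ {a b c d} → a ≋ b [mod m ] → c ≋ d [mod m ] → a + c ≋ b + d [mod m ]
    +-cong≋ {b = b} {d = d} (≋-by q refl) (≋-by q′ refl) = ≋-by (q + q′) (collect b d q q′ (+ m))
      where
      collect : ∀ b d q q′ m → b + q * m + (d + q′ * m) ≡ b + d + (q + q′) * m
      collect = solve-∀

    +-congˡ≋ : ∀ a {c d} → c ≋ d [mod m ] → a + c ≋ a + d [mod m ]
    +-congˡ≋ a = +-cong≋ (≋-refl {a})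

    neg-cong≋ : ∀ {a b} → a ≋ b [mod m ] → - a ≋ - b [mod m ]
    neg-cong≋ {b = b} (≋-by q refl) = ≋-by (- q) (neg-distrib b q (+ m))
      where
      neg-distrib : ∀ b q m → - (b + q * m) ≡ - b + - q * m
      neg-distrib = solve-∀

    -‿cong≋ : ∀ {a b c d} → a ≋ b [mod m ] → c ≋ d [mod m ] → a - c ≋ b - d [mod m ]
    -‿cong≋ a≋b c≋d = +-cong≋ a≋b (neg-cong≋ c≋d)

    *-cong≋ : ∀ {a b c d} → a ≋ b [mod m ] → c ≋ d [mod m ] → a * c ≋ b * d [mod m ]
    *-cong≋ {b = b} {d = d} (≋-by q refl) (≋-by q′ refl) =
      ≋-by (q * d + b * q′ + q * q′ * + m) (expand b d q q′ (+ m))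
      where
      expand : ∀ b d q q′ m → (b + q * m) * (d + q′ * m) ≡ b * d + (q * d + b * q′ + q * q′ * m) * m
      expand = solve-∀

    *-congˡ≋ : ∀ c {a b} → a ≋ b [mod m ] → c * a ≋ c * b [mod m ]
    *-congˡ≋ c = *-cong≋ (≋-refl {c})

    *-congʳ≋ : ∀ c {a b} → a ≋ b [mod m ] → a * c ≋ b * c [mod m ]
    *-congʳ≋ c a≋b = *-cong≋ a≋b (≋-refl {c})

    ^-cong≋ : ∀ {a b} e → a ≋ b [mod m ] → a ^ e ≋ b ^ e [mod m ]
    ^-cong≋ zero    a≋b = ≋-refl
    ^-cong≋ (suc e) a≋b = *-cong≋ a≋b (^-cong≋ e a≋b)

    sumFin-cong≋ : ∀ n {f g : Fin n → ℤ} → (∀ i → f i ≋ g i [mod m ]) → sumFin n f ≋ sumFin n g [mod m ]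
    sumFin-cong≋ zero    f≋g = ≋-refl
    sumFin-cong≋ (suc n) f≋g = +-cong≋ (f≋g Fin.zero) (sumFin-cong≋ n (f≋g ∘ Fin.suc))

    ≋-cancelʳ : ∀ {a b} c → a + c ≋ b + c [mod m ] → a ≋ b [mod m ]
    ≋-cancelʳ {a} {b} c a+c≋b+c =
      ≋-trans (≡⇒≋ (a≡a+c-c a c)) (≋-trans (-‿cong≋ a+c≋b+c (≋-refl {c})) (≡⇒≋ (sym (a≡a+c-c b c))))
      where
      a≡a+c-c : ∀ a c → a ≡ a + c - c
      a≡a+c-c = solve-∀

    ≋-cancelˡ : ∀ a {b c} → a + b ≋ a + c [mod m ] → b ≋ c [mod m ]
    ≋-cancelˡ a {b} {c} a+b≋a+c =
      ≋-cancelʳ a (≋-trans (≡⇒≋ (ℤ.+-comm b a)) (≋-trans a+b≋a+c (≡⇒≋ (ℤ.+-comm a c))))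

    ≋⇒-≋0 : ∀ {a b} → a ≋ b [mod m ] → a - b ≋ 0ℤ [mod m ]
    ≋⇒-≋0 {b = b} a≋b = ≋-trans (-‿cong≋ a≋b (≋-refl {b})) (≡⇒≋ (ℤ.+-inverseʳ b))

    -≋0⇒≋ : ∀ {a b} → a - b ≋ 0ℤ [mod m ] → a ≋ b [mod m ]
    -≋0⇒≋ {b = b} a-b≋0 = ≋-cancelʳ (- b) (≋-trans a-b≋0 (≡⇒≋ (sym (ℤ.+-inverseʳ b))))

  module ≋-Reasoning (m : ℕ) = SetoidReasoning (≋-setoid {m})

  ≋-weaken : ∀ {m n a b} → m ℕ.∣ n → a ≋ b [mod n ] → a ≋ b [mod m ]
  ≋-weaken {m} {b = b} (ℕ.divides d refl) (≋-by q refl) =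
    ≋-by (q * + d) (cong (_+_ b) (trans (cong (q *_) (ℤ.pos-* d m)) (sym (ℤ.*-assoc q (+ d) (+ m)))))

  ≋-modulus : ∀ {m n a b} → m ≡ n → a ≋ b [mod m ] → a ≋ b [mod n ]
  ≋-modulus refl a≋b = a≋b

  *-scale≋ : ∀ {m a b} n → a ≋ b [mod m ] → + n * a ≋ + n * b [mod m ℕ.* n ]
  *-scale≋ {m} {b = b} n (≋-by q refl) =
    ≋-by q (trans (distribute (+ n) b q (+ m)) (cong (λ k → + n * b + q * k) (sym (ℤ.pos-* m n))))
    where
    distribute : ∀ n b q m → n * (b + q * m) ≡ n * b + q * (m * n)
    distribute = solve-∀

  ≋-refine : ∀ {a b m n} (a≋b : a ≋ b [mod m ]) → _≋_[mod_].quotient a≋b ≋ 0ℤ [mod n ] → a ≋ b [mod n ℕ.* m ]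
  ≋-refine {b = b} {m} {n} (≋-by q refl) (≋-by q′ q≡0+q′n) =
    ≋-by q′ (trans (cong (λ s → b + s * + m) q≡0+q′n)
                   (trans (regroup b q′ (+ n) (+ m)) (cong (λ s → b + q′ * s) (sym (ℤ.pos-* n m)))))
    where
    regroup : ∀ b q′ n m → b + (0ℤ + q′ * n) * m ≡ b + q′ * (n * m)
    regroup = solve-∀

  *-cancel-scale≋ : ∀ {m a b} n .{{_ : NonZero n}} → + n * a ≋ + n * b [mod m ℕ.* n ] → a ≋ b [mod m ]
  *-cancel-scale≋ {m} {a} {b} n (≋-by q eq) =
    ≋-by q (ℤ.*-cancelˡ-≡ (+ n) a (b + q * + m) (trans eq (trans (cong (λ k → + n * b + q * k) (ℤ.pos-* m n))
                                                                    (factor (+ n) b q (+ m)))))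
    where
    factor : ∀ n b q m → n * b + q * (m * n) ≡ n * (b + q * m)
    factor = solve-∀

  ≡[mod]⇒≋ : ∀ {a b m} → a ≡ b [mod m ] → a ≋ b [mod m ]
  ≡[mod]⇒≋ {a} {b} a≡b with Signed.divides q a-b≡q*m ← Signed.∣ᵤ⇒∣ a≡b =
    ≋-by q (trans (a≡b+[a-b] a b) (cong (_+_ b) a-b≡q*m))
    where
    a≡b+[a-b] : ∀ a b → a ≡ b + (a - b)
    a≡b+[a-b] = solve-∀

  ≋⇒≡[mod] : ∀ {a b m} → a ≋ b [mod m ] → a ≡ b [mod m ]
  ≋⇒≡[mod] {b = b} {m} (≋-by q refl) = Signed.∣⇒∣ᵤ (Signed.divides q (b+x-b≡x b (q * + m)))
    where
    b+x-b≡x : ∀ b x → b + x - b ≡ x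
    b+x-b≡x = solve-∀

  ≋0⇒∣ : ∀ {a m} → a ≋ 0ℤ [mod m ] → + m ℤ.∣ a
  ≋0⇒∣ {a} {m} a≋0 = subst (+ m ℤ.∣_) (ℤ.+-identityʳ a) (≋⇒≡[mod] a≋0)

  ∣⇒≋0 : ∀ {a m} → + m ℤ.∣ a → a ≋ 0ℤ [mod m ]
  ∣⇒≋0 {a} {m} m∣a = ≡[mod]⇒≋ (subst (+ m ℤ.∣_) (sym (ℤ.+-identityʳ a)) m∣a)

  euclidsLemma≋ : ∀ {p} → Prime p → ∀ a b → a * b ≋ 0ℤ [mod p ] → a ≋ 0ℤ [mod p ] ⊎ b ≋ 0ℤ [mod p ]
  euclidsLemma≋ {p} p-prime a b ab≋0
    with euclidsLemma ∣ a ∣ ∣ b ∣ p-prime (subst (p ℕ.∣_) (ℤ.abs-* a b) (≋0⇒∣ ab≋0))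
  ... | inj₁ p∣a = inj₁ (∣⇒≋0 p∣a)
  ... | inj₂ p∣b = inj₂ (∣⇒≋0 p∣b)

  ≋-%ℕ : ∀ {m} .{{_ : NonZero m}} a → a ≋ + (a ℤ.%ℕ m) [mod m ]
  ≋-%ℕ {m} a = ≋-by (a ℤ./ℕ m) (ℤ.a≡a%ℕn+[a/ℕn]*n a m)

  ≋-nat-apart : ∀ {a b m} → + a ≋ + b [mod m ] → b ℕ.≤ a → ∃ λ s → a ≡ b ℕ.+ m ℕ.* s
  ≋-nat-apart {a} {b} {m} a≋b b≤a = multiple (subst (m ℕ.∣_) ∣a-b∣≡a∸b (≋⇒≡[mod] a≋b))
    where
    ∣a-b∣≡a∸b : ∣ + a - + b ∣ ≡ a ℕ.∸ b
    ∣a-b∣≡a∸b = trans (cong ∣_∣ (ℤ.m-n≡m⊖n a b)) (trans (ℤ.∣m⊖n∣≡∣n⊖m∣ a b) (ℤ.∣⊖∣-≤ b≤a))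
    multiple : m ℕ.∣ a ℕ.∸ b → ∃ λ s → a ≡ b ℕ.+ m ℕ.* s
    multiple (ℕ.divides s eq) = s , trans (sym (ℕ.m+[n∸m]≡n b≤a)) (cong (b ℕ.+_) (trans eq (ℕ.*-comm s m)))

  pos-+-* : ∀ b n w → + (b ℕ.+ n ℕ.* w) ≡ + b + + n * + w
  pos-+-* b n w = trans (ℤ.pos-+ b (n ℕ.* w)) (cong (_+_ (+ b)) (ℤ.pos-* n w))

  +-multipleℕ≋ : ∀ b n w → + (b ℕ.+ n ℕ.* w) ≋ + b [mod n ]
  +-multipleℕ≋ b n w = ≋-by (+ w) (trans (pos-+-* b n w) (cong (_+_ (+ b)) (ℤ.*-comm (+ n) (+ w))))

  record CommonBase (a b m : ℕ) : Set where
    constructor common-base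
    field
      base stepsˡ stepsʳ : ℕ
      eqˡ : a ≡ base ℕ.+ m ℕ.* stepsˡ
      eqʳ : b ≡ base ℕ.+ m ℕ.* stepsʳ

  m+n*0≡m : ∀ m n → m ℕ.+ n ℕ.* 0 ≡ m
  m+n*0≡m m n = trans (cong (m ℕ.+_) (ℕ.*-zeroʳ n)) (ℕ.+-identityʳ m)

  ≋-nat-common-base : ∀ {a b m} → + a ≋ + b [mod m ] → CommonBase a b m
  ≋-nat-common-base {a} {b} {m} a≋b with ℕ.≤-total b a
  ... | inj₁ b≤a with s , a≡ ← ≋-nat-apart a≋b b≤a = common-base b s 0 a≡ (sym (m+n*0≡m b m))
  ... | inj₂ a≤b with s , b≡ ← ≋-nat-apart (≋-sym a≋b) a≤b = common-base a 0 s (sym (m+n*0≡m a m)) b≡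

  base≋ʳ : ∀ {a b m} (cb : CommonBase a b m) → + CommonBase.base cb ≋ + b [mod m ]
  base≋ʳ {m = m} (common-base c _ s _ refl) = ≋-sym (+-multipleℕ≋ c m s)

  m≤c+m*[1+s] : ∀ m c s → m ℕ.≤ c ℕ.+ m ℕ.* suc s
  m≤c+m*[1+s] m c s = ℕ.≤-trans (ℕ.m≤m*n m (suc s)) (ℕ.m≤n+m (m ℕ.* suc s) c)

  ≋-nat-injective : ∀ {a b m} → a ℕ.< m → b ℕ.< m → + a ≋ + b [mod m ] → a ≡ b
  ≋-nat-injective {m = m} a<m b<m a≋b with ≋-nat-common-base a≋b
  ... | common-base c zero    zero    refl refl = refl
  ... | common-base c (suc s) _       refl _    = contradiction a<m (ℕ.≤⇒≯ (m≤c+m*[1+s] m c s))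
  ... | common-base c _       (suc s) _    refl = contradiction b<m (ℕ.≤⇒≯ (m≤c+m*[1+s] m c s))

  +-*-scaleℕ≋ : ∀ {m} b n {w w′} → + w ≋ + w′ [mod m ] → + (b ℕ.+ n ℕ.* w) ≋ + (b ℕ.+ n ℕ.* w′) [mod m ℕ.* n ]
  +-*-scaleℕ≋ b n {w} {w′} w≋w′ =
    ≋-trans (≡⇒≋ (pos-+-* b n w)) (≋-trans (+-congˡ≋ (+ b) (*-scale≋ n w≋w′)) (≡⇒≋ (sym (pos-+-* b n w′))))

module FinSum where

  open import Data.Nat.Base as ℕ using (ℕ; zero; suc)
  open import Data.Integer.Base as ℤ using (ℤ; 0ℤ; _-_; _*_; _+_; -_)
  import Data.Integer.Properties as ℤ
  open import Data.Integer.Tactic.RingSolver using (solve-∀)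
  open import Data.Fin.Base as Fin using (Fin; _↑ˡ_; _↑ʳ_)
  import Data.Fin.Properties as Fin
  open import Function.Base using (_∘_)
  open import Relation.Binary.PropositionalEquality
  open import Relation.Nullary.Negation using (contradiction)

  sumFin-cong : ∀ n {f g : Fin n → ℤ} → (∀ i → f i ≡ g i) → sumFin n f ≡ sumFin n g
  sumFin-cong zero    f≡g = refl
  sumFin-cong (suc n) f≡g = cong₂ _+_ (f≡g Fin.zero) (sumFin-cong n (f≡g ∘ Fin.suc))

  sumFin-zero : ∀ n {f : Fin n → ℤ} → (∀ i → f i ≡ 0ℤ) → sumFin n f ≡ 0ℤ
  sumFin-zero zero    f≡0 = refl
  sumFin-zero (suc n) f≡0 = cong₂ _+_ (f≡0 Fin.zero) (sumFin-zero n (f≡0 ∘ Fin.suc))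

  sumFin-+ : ∀ n (f g : Fin n → ℤ) → sumFin n (λ i → f i + g i) ≡ sumFin n f + sumFin n g
  sumFin-+ zero    f g = refl
  sumFin-+ (suc n) f g =
    trans (cong (_+_ (f Fin.zero + g Fin.zero)) (sumFin-+ n (f ∘ Fin.suc) (g ∘ Fin.suc)))
          (interchange (f Fin.zero) (g Fin.zero) (sumFin n (f ∘ Fin.suc)) (sumFin n (g ∘ Fin.suc)))
    where
    interchange : ∀ a b c d → a + b + (c + d) ≡ a + c + (b + d)
    interchange = solve-∀

  *-distribˡ-sumFin : ∀ n c (f : Fin n → ℤ) → c * sumFin n f ≡ sumFin n (λ i → c * f i)
  *-distribˡ-sumFin zero    c f = ℤ.*-zeroʳ c
  *-distribˡ-sumFin (suc n) c f =
    trans (ℤ.*-distribˡ-+ c (f Fin.zero) _) (cong (_+_ (c * f Fin.zero)) (*-distribˡ-sumFin n c (f ∘ Fin.suc)))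

  sumFin-linear : ∀ n a b (f g : Fin n → ℤ) → sumFin n (λ i → a * f i + b * g i) ≡ a * sumFin n f + b * sumFin n g
  sumFin-linear n a b f g =
    trans (sumFin-+ n (λ i → a * f i) (λ i → b * g i)) (sym (cong₂ _+_ (*-distribˡ-sumFin n a f) (*-distribˡ-sumFin n b g)))

  sumFin-++ : ∀ m n (f : Fin (m ℕ.+ n) → ℤ) →
              sumFin (m ℕ.+ n) f ≡ sumFin m (λ i → f (i ↑ˡ n)) + sumFin n (λ j → f (m ↑ʳ j))
  sumFin-++ zero    n f = sym (ℤ.+-identityˡ _)
  sumFin-++ (suc m) n f =
    trans (cong (_+_ (f Fin.zero)) (sumFin-++ m n (f ∘ Fin.suc))) (sym (ℤ.+-assoc (f Fin.zero) _ _))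

  sumFin-single : ∀ n (f : Fin n → ℤ) c → (∀ i → i ≢ c → f i ≡ 0ℤ) → sumFin n f ≡ f c
  sumFin-single (suc n) f Fin.zero    f≡0 =
    trans (cong (_+_ (f Fin.zero)) (sumFin-zero n (λ i → f≡0 (Fin.suc i) λ ()))) (ℤ.+-identityʳ (f Fin.zero))
  sumFin-single (suc n) f (Fin.suc c) f≡0 =
    trans (cong (_+ sumFin n (f ∘ Fin.suc)) (f≡0 Fin.zero λ ()))
          (trans (ℤ.+-identityˡ _) (sumFin-single n (f ∘ Fin.suc) c (λ i i≢c → f≡0 (Fin.suc i) (i≢c ∘ Fin.suc-injective))))

  sumFin-pair : ∀ n (f : Fin n → ℤ) {c d} → c ≢ d → (∀ i → i ≢ c → i ≢ d → f i ≡ 0ℤ) → sumFin n f ≡ f c + f d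
  sumFin-pair (suc n) f {Fin.zero}  {Fin.zero}  c≢d f≡0 = contradiction refl c≢d
  sumFin-pair (suc n) f {Fin.zero}  {Fin.suc d} c≢d f≡0 =
    cong (_+_ (f Fin.zero)) (sumFin-single n (f ∘ Fin.suc) d (λ i i≢d → f≡0 (Fin.suc i) (λ ()) (i≢d ∘ Fin.suc-injective)))
  sumFin-pair (suc n) f {Fin.suc c} {Fin.zero}  c≢d f≡0 =
    trans (cong (_+_ (f Fin.zero)) (sumFin-single n (f ∘ Fin.suc) c (λ i i≢c → f≡0 (Fin.suc i) (i≢c ∘ Fin.suc-injective) (λ ()))))
          (ℤ.+-comm (f Fin.zero) (f (Fin.suc c)))
  sumFin-pair (suc n) f {Fin.suc c} {Fin.suc d} c≢d f≡0 =
    trans (cong (_+ sumFin n (f ∘ Fin.suc)) (f≡0 Fin.zero (λ ()) (λ ())))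
          (trans (ℤ.+-identityˡ _) (sumFin-pair n (f ∘ Fin.suc) (c≢d ∘ cong Fin.suc)
                                     (λ i i≢c i≢d → f≡0 (Fin.suc i) (i≢c ∘ Fin.suc-injective) (i≢d ∘ Fin.suc-injective))))

  sumFin-antisym : ∀ n (f g : Fin n → ℤ) {c d} → c ≢ d →
    (∀ i → i ≢ c → i ≢ d → f i ≡ - g i) → f c ≡ - g d → f d ≡ - g c → sumFin n f ≡ - sumFin n g
  sumFin-antisym n f g {c} {d} c≢d f≡-g fc≡-gd fd≡-gc = begin
      sumFin n f                                  ≡⟨ a≡a+b-b (sumFin n f) (sumFin n g) ⟩
      sumFin n f + sumFin n g - sumFin n g        ≡⟨ cong (_- sumFin n g) (sumFin-+ n f g) ⟨
      sumFin n (λ i → f i + g i) - sumFin n g     ≡⟨ cong (_- sumFin n g) f+g≡0 ⟩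
      0ℤ - sumFin n g                             ≡⟨ ℤ.+-identityˡ (- sumFin n g) ⟩
      - sumFin n g                                ∎
    where
    open ≡-Reasoning
    a≡a+b-b : ∀ a b → a ≡ a + b - b
    a≡a+b-b = solve-∀
    cancel : ∀ a b → - b + a + (- a + b) ≡ 0ℤ
    cancel = solve-∀
    f+g≡0 : sumFin n (λ i → f i + g i) ≡ 0ℤ
    f+g≡0 = trans (sumFin-pair n (λ i → f i + g i) c≢d (λ i i≢c i≢d → trans (cong (_+ g i) (f≡-g i i≢c i≢d)) (ℤ.+-inverseˡ (g i))))
                  (trans (cong₂ _+_ (cong (_+ g c) fc≡-gd) (cong (_+ g d) fd≡-gc)) (cancel (g c) (g d)))

module Fermat where

  open Congruence
  open FinSum
  open import Data.Nat.Base as ℕ using (ℕ; zero; suc)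
  import Data.Nat.Properties as ℕ
  import Data.Nat.Divisibility as ℕ
  open import Data.Nat.Combinatorics using (_C_; nC1≡n; nCn≡1; nCk+nC[k+1]≡[n+1]C[k+1])
  open import Data.Nat.Primality using (Prime; euclidsLemma)
  open import Data.Integer.Base as ℤ using (ℤ; +_; 0ℤ; 1ℤ; _-_; _*_; _+_; -_; _^_)
  import Data.Integer.Properties as ℤ
  import Data.Integer.DivMod as ℤ
  open import Data.Integer.Tactic.RingSolver using (solve-∀)
  open import Data.Fin.Base as Fin using (Fin; toℕ; inject₁)
  import Data.Fin.Properties as Fin
  open import Data.Sum.Base using (inj₁; inj₂; [_,_]′)
  open import Function.Base using (_∘_)
  open import Relation.Binary.PropositionalEquality
  open import Relation.Nullary.Negation using (¬_; contradiction)
  import Algebra.Properties.CommutativeSemiring.Binomial ℤ.+-*-commutativeSemiring as Binomial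
  open import Algebra.Properties.Monoid.Sum ℤ.+-0-monoid using (sum-init-last)
  import Algebra.Definitions.RawMonoid ℤ.+-0-rawMonoid as Additive
  import Algebra.Definitions.RawSemiring ℤ.+-*-rawSemiring as Semiring

  sumFin≡sum : ∀ n (f : Fin n → ℤ) → sumFin n f ≡ Additive.sum f
  sumFin≡sum zero    f = refl
  sumFin≡sum (suc n) f = cong (_+_ (f Fin.zero)) (sumFin≡sum n (f ∘ Fin.suc))

  ×≡* : ∀ n a → n Additive.× a ≡ + n * a
  ×≡* zero    a = sym (ℤ.*-zeroˡ a)
  ×≡* (suc n) a = trans (cong (_+_ a) (×≡* n a)) (sym (trans (cong (_* a) (ℤ.pos-+ 1 n)) ([1+n]*a≡a+n*a (+ n) a)))
    where
    [1+n]*a≡a+n*a : ∀ n a → (1ℤ + n) * a ≡ a + n * a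
    [1+n]*a≡a+n*a = solve-∀

  ^≡^ : ∀ a n → a Semiring.^ n ≡ a ^ n
  ^≡^ a zero    = refl
  ^≡^ a (suc n) = cong (a *_) (^≡^ a n)

  [1+k]*[1+n]C[1+k]≡[1+n]*nCk : ∀ n k → suc k ℕ.* (suc n C suc k) ≡ suc n ℕ.* (n C k)
  [1+k]*[1+n]C[1+k]≡[1+n]*nCk zero    zero    = refl
  [1+k]*[1+n]C[1+k]≡[1+n]*nCk zero    (suc k) = ℕ.*-zeroʳ (suc (suc k))
  [1+k]*[1+n]C[1+k]≡[1+n]*nCk (suc n) zero    =
    trans (ℕ.+-identityʳ _) (trans (nC1≡n (suc (suc n))) (sym (ℕ.*-identityʳ (suc (suc n)))))
  [1+k]*[1+n]C[1+k]≡[1+n]*nCk (suc n) (suc k) = begin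
      suc (suc k) ℕ.* (suc (suc n) C suc (suc k))
    ≡⟨ cong (suc (suc k) ℕ.*_) (nCk+nC[k+1]≡[n+1]C[k+1] (suc n) (suc k)) ⟨
      suc (suc k) ℕ.* (suc n C suc k ℕ.+ suc n C suc (suc k))
    ≡⟨ ℕ.*-distribˡ-+ (suc (suc k)) (suc n C suc k) _ ⟩
      suc n C suc k ℕ.+ suc k ℕ.* (suc n C suc k) ℕ.+ suc (suc k) ℕ.* (suc n C suc (suc k))
    ≡⟨ cong₂ (λ a b → suc n C suc k ℕ.+ a ℕ.+ b) ([1+k]*[1+n]C[1+k]≡[1+n]*nCk n k) ([1+k]*[1+n]C[1+k]≡[1+n]*nCk n (suc k)) ⟩
      suc n C suc k ℕ.+ suc n ℕ.* (n C k) ℕ.+ suc n ℕ.* (n C suc k)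
    ≡⟨ ℕ.+-assoc (suc n C suc k) _ _ ⟩
      suc n C suc k ℕ.+ (suc n ℕ.* (n C k) ℕ.+ suc n ℕ.* (n C suc k))
    ≡⟨ cong (suc n C suc k ℕ.+_) (trans (sym (ℕ.*-distribˡ-+ (suc n) (n C k) (n C suc k)))
                                         (cong (suc n ℕ.*_) (nCk+nC[k+1]≡[n+1]C[k+1] n k))) ⟩
      suc (suc n) ℕ.* (suc n C suc k)
    ∎
    where open ≡-Reasoning

  module _ {p′ : ℕ} (p-prime : Prime (suc p′)) where

    private
      p : ℕ
      p = suc p′

    p∣pCk : ∀ {k} → 0 ℕ.< k → k ℕ.< p → p ℕ.∣ p C k
    p∣pCk {suc k} _ k<p
      with euclidsLemma (suc k) (p C suc k) p-prime
             (ℕ.divides (p′ C k) (trans ([1+k]*[1+n]C[1+k]≡[1+n]*nCk p′ k) (ℕ.*-comm p (p′ C k))))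
    ... | inj₁ p∣1+k = contradiction (ℕ.∣⇒≤ p∣1+k) (ℕ.<⇒≱ k<p)
    ... | inj₂ p∣pCk = p∣pCk

    freshman's-dream : ∀ a → (a + 1ℤ) ^ p ≋ a ^ p + 1ℤ [mod p ]
    freshman's-dream a = begin
        (a + 1ℤ) ^ p
      ≡⟨ ^≡^ (a + 1ℤ) p ⟨
        (a + 1ℤ) Semiring.^ p
      ≡⟨ Binomial.theorem p a 1ℤ ⟩
        Additive.sum (Binomial.binomialTerm a 1ℤ p)
      ≡⟨ sumFin≡sum (suc p) (Binomial.binomialTerm a 1ℤ p) ⟨
        sumFin (suc p) (Binomial.binomialTerm a 1ℤ p)
      ≡⟨ sumFin-cong (suc p) binomialTerm≡term ⟩
        term 0 + sumFin p middle
      ≡⟨ cong (_+_ (term 0)) (trans (sumFin≡sum p middle)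
                              (trans (sum-init-last middle)
                                     (cong₂ _+_ (sym (sumFin≡sum p′ (middle ∘ inject₁))) (cong (term ∘ suc) (Fin.toℕ-fromℕ p′))))) ⟩
        term 0 + (sumFin p′ (middle ∘ inject₁) + term p)
      ≈⟨ +-congˡ≋ (term 0) (+-cong≋ (sumFin-cong≋ p′ middle≋0) (≋-refl {a = term p})) ⟩
        term 0 + (sumFin p′ (λ _ → 0ℤ) + term p)
      ≡⟨ cong₂ (λ s t → 1ℤ + (s + t)) (sumFin-zero p′ (λ _ → refl))
               (trans (cong (λ c → + c * a ^ p) (nCn≡1 p)) (ℤ.*-identityˡ (a ^ p))) ⟩
        1ℤ + (0ℤ + a ^ p)
      ≡⟨ trans (cong (_+_ 1ℤ) (ℤ.+-identityˡ (a ^ p))) (ℤ.+-comm 1ℤ (a ^ p)) ⟩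
        a ^ p + 1ℤ
      ∎
      where
      open ≋-Reasoning p
      term : ℕ → ℤ
      term k = + (p C k) * a ^ k
      middle : Fin p → ℤ
      middle k = term (suc (toℕ k))
      binomialTerm≡term : ∀ k → Binomial.binomialTerm a 1ℤ p k ≡ term (toℕ k)
      binomialTerm≡term k = trans (×≡* (p C toℕ k) _) (cong (+ (p C toℕ k) *_)
        (trans (cong₂ _*_ (^≡^ a (toℕ k)) (trans (^≡^ 1ℤ (p ℕ.∸ toℕ k)) (ℤ.^-zeroˡ (p ℕ.∸ toℕ k))))
               (ℤ.*-identityʳ (a ^ toℕ k))))
      middle≋0 : ∀ k → middle (inject₁ k) ≋ 0ℤ [mod p ]
      middle≋0 k
        with ℕ.divides c pCj≡c*p ← p∣pCk (ℕ.s≤s ℕ.z≤n) (ℕ.s≤s (subst (ℕ._< p′) (sym (Fin.toℕ-inject₁ k)) (Fin.toℕ<n k))) =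
        ≋-trans (≡⇒≋ (trans (cong (λ n → + n * a ^ j) pCj≡c*p)
                            (trans (cong (_* a ^ j) (ℤ.pos-* c p)) (rearrange (+ c) (+ p) (a ^ j)))))
                (multiple≋0 (+ c * a ^ j))
        where
        j : ℕ
        j = suc (toℕ (inject₁ k))
        rearrange : ∀ c p x → c * p * x ≡ c * x * p
        rearrange = solve-∀

    fermat-ℕ : ∀ n → (+ n) ^ p ≋ + n [mod p ]
    fermat-ℕ zero    = ≋-refl
    fermat-ℕ (suc n) = begin
        (+ suc n) ^ p     ≡⟨ cong (_^ p) (trans (ℤ.pos-+ 1 n) (ℤ.+-comm 1ℤ (+ n))) ⟩
        (+ n + 1ℤ) ^ p    ≈⟨ freshman's-dream (+ n) ⟩
        (+ n) ^ p + 1ℤ    ≈⟨ +-cong≋ (fermat-ℕ n) ≋-refl ⟩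
        + n + 1ℤ          ≡⟨ trans (ℤ.+-comm (+ n) 1ℤ) (sym (ℤ.pos-+ 1 n)) ⟩
        + suc n           ∎
      where open ≋-Reasoning p

    fermat : ∀ a → a ^ p ≋ a [mod p ]
    fermat a = begin
        a ^ p               ≈⟨ ^-cong≋ p (≋-%ℕ a) ⟩
        (+ (a ℤ.%ℕ p)) ^ p  ≈⟨ fermat-ℕ (a ℤ.%ℕ p) ⟩
        + (a ℤ.%ℕ p)        ≈⟨ ≋-%ℕ a ⟨
        a                   ∎
      where open ≋-Reasoning p

    fermat-unit : ∀ {a} → ¬ (a ≋ 0ℤ [mod p ]) → a ^ p′ ≋ 1ℤ [mod p ]
    fermat-unit {a} a≉0 =
      [ (λ a≋0 → contradiction a≋0 a≉0) , ≋-cancelʳ (- 1ℤ) ]′ (euclidsLemma≋ p-prime a (a ^ p′ - 1ℤ) a[a^p′-1]≋0)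
      where
      a[a^p′-1]≋0 : a * (a ^ p′ - 1ℤ) ≋ 0ℤ [mod p ]
      a[a^p′-1]≋0 = begin
        a * (a ^ p′ - 1ℤ)  ≡⟨ ℤ.*-distribˡ-+ a (a ^ p′) (- 1ℤ) ⟩
        a ^ p + a * - 1ℤ   ≡⟨ cong (_+_ (a ^ p)) (trans (ℤ.*-comm a (- 1ℤ)) (ℤ.-1*i≡-i a)) ⟩
        a ^ p - a          ≈⟨ -‿cong≋ (fermat a) ≋-refl ⟩
        a - a              ≡⟨ ℤ.+-inverseʳ a ⟩
        0ℤ                 ∎
        where open ≋-Reasoning p

    fermat-exponent : ∀ {a e e′} → ¬ (a ≋ 0ℤ [mod p ]) → + e ≋ + e′ [mod p′ ] → a ^ e ≋ a ^ e′ [mod p ]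
    fermat-exponent {a} a≉0 e≋e′ with ≋-nat-common-base e≋e′
    ... | common-base c s s′ refl refl = ≋-trans (absorb s) (≋-sym (absorb s′))
      where
      absorb : ∀ s → a ^ (c ℕ.+ p′ ℕ.* s) ≋ a ^ c [mod p ]
      absorb s = begin
        a ^ (c ℕ.+ p′ ℕ.* s)    ≡⟨ ℤ.^-distribˡ-+-* a c (p′ ℕ.* s) ⟩
        a ^ c * a ^ (p′ ℕ.* s)  ≡⟨ cong (a ^ c *_) (ℤ.^-*-assoc a p′ s) ⟨
        a ^ c * (a ^ p′) ^ s    ≈⟨ *-congˡ≋ (a ^ c) (^-cong≋ s (fermat-unit a≉0)) ⟩
        a ^ c * 1ℤ ^ s          ≡⟨ trans (cong (a ^ c *_) (ℤ.^-zeroˡ s)) (ℤ.*-identityʳ (a ^ c)) ⟩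
        a ^ c                   ∎
        where open ≋-Reasoning p

    e₂-spec : ∀ {a} → ¬ (a ≋ 0ℤ [mod p ]) → a ^ p′ ≡ 1ℤ + + p * e₂ p a
    e₂-spec {a} a≉0 = begin
        a ^ p′                      ≡⟨ b≡1+[b-1] (a ^ p′) ⟩
        1ℤ + (a ^ p′ - 1ℤ)          ≡⟨ cong (_+_ 1ℤ) (ℤ.a≡a%ℕn+[a/ℕn]*n (a ^ p′ - 1ℤ) p) ⟩
        1ℤ + (+ r + e₂ p a * + p)   ≡⟨ cong (λ r → 1ℤ + (+ r + e₂ p a * + p)) r≡0 ⟩
        1ℤ + (0ℤ + e₂ p a * + p)    ≡⟨ cong (_+_ 1ℤ) (trans (ℤ.+-identityˡ _) (ℤ.*-comm (e₂ p a) (+ p))) ⟩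
        1ℤ + + p * e₂ p a           ∎
      where
      open ≡-Reasoning
      r : ℕ
      r = (a ^ p′ - 1ℤ) ℤ.%ℕ p
      b≡1+[b-1] : ∀ b → b ≡ 1ℤ + (b - 1ℤ)
      b≡1+[b-1] = solve-∀
      r≡0 : r ≡ 0
      r≡0 = ≋-nat-injective (ℤ.n%ℕd<d (a ^ p′ - 1ℤ) p) (ℕ.s≤s ℕ.z≤n)
                            (≋-trans (≋-sym (≋-%ℕ (a ^ p′ - 1ℤ))) (≋⇒-≋0 (fermat-unit a≉0)))

module Totient where

  open import Data.Nat.Base as ℕ using (ℕ; zero; suc; _+_; _*_; _^_; _≤_)
  import Data.Nat.Properties as ℕ
  open import Data.Nat.Divisibility using (_∣_; ∣-trans; ∣1⇒≡1; m∣m*n; ∣m+n∣m⇒∣n; ∣⇒≤)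
  open import Data.Nat.Coprimality using (Coprime; coprime?; coprime-divisor)
  open import Data.Nat.Primality using (Prime; prime⇒irreducible; prime⇒nonTrivial)
  import Data.Nat.Tactic.RingSolver as ℕ-Solver
  open import Data.List.Base using ([_]; _++_; length; filter; map; upTo)
  import Data.List.Properties as List
  open import Data.Product.Base using (_,_)
  open import Data.Sum.Base using (inj₁; inj₂)
  open import Function.Base using (_∘′_)
  open import Relation.Binary.PropositionalEquality hiding ([_])
  open import Relation.Nullary.Decidable using (Dec)
  open import Relation.Nullary.Negation using (¬_; contradiction)

  module _ {p′ : ℕ} (p-prime : Prime (suc p′)) where

    private
      p : ℕ
      p = suc p′

    ¬p∣⇒coprime-^ : ∀ {m} e → ¬ p ∣ m → Coprime m (p ^ e)
    ¬p∣⇒coprime-^ zero    p∤m (_ , d∣1) = ∣1⇒≡1 d∣1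
    ¬p∣⇒coprime-^ (suc e) p∤m {d} (d∣m , d∣p^[1+e]) =
      ¬p∣⇒coprime-^ e p∤m (d∣m , coprime-divisor d-coprime-p d∣p^[1+e])
      where
      d-coprime-p : Coprime d p
      d-coprime-p {c} (c∣d , c∣p) with prime⇒irreducible p-prime c∣p
      ... | inj₁ c≡1  = c≡1
      ... | inj₂ refl = contradiction (∣-trans c∣d d∣m) p∤m

    p∣⇒¬coprime-^ : ∀ {m} e → p ∣ m → ¬ Coprime m (p ^ suc e)
    p∣⇒¬coprime-^ e p∣m coprime = ℕ.nonTrivial⇒≢1 {{prime⇒nonTrivial p-prime}} (coprime (p∣m , m∣m*n (p ^ e)))

    module _ (k : ℕ) where

      private
        coprime-to-p^[1+k]? : ∀ m → Dec (Coprime m (p ^ suc k))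
        coprime-to-p^[1+k]? m = coprime? m (p ^ suc k)

      coprimeCount : ℕ → ℕ
      coprimeCount n = length (filter coprime-to-p^[1+k]? (map suc (upTo n)))

      coprimeCount-suc : ∀ n → coprimeCount (suc n) ≡ coprimeCount n + length (filter coprime-to-p^[1+k]? [ suc n ])
      coprimeCount-suc n = begin
          length (filter coprime-to-p^[1+k]? (map suc (upTo (suc n))))
        ≡⟨ cong (length ∘′ filter coprime-to-p^[1+k]? ∘′ map suc) (List.upTo-∷ʳ n) ⟨
          length (filter coprime-to-p^[1+k]? (map suc (upTo n ++ [ n ])))
        ≡⟨ cong (length ∘′ filter coprime-to-p^[1+k]?) (List.map-++ suc (upTo n) [ n ]) ⟩
          length (filter coprime-to-p^[1+k]? (map suc (upTo n) ++ [ suc n ]))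
        ≡⟨ cong length (List.filter-++ coprime-to-p^[1+k]? (map suc (upTo n)) [ suc n ]) ⟩
          length (filter coprime-to-p^[1+k]? (map suc (upTo n)) ++ filter coprime-to-p^[1+k]? [ suc n ])
        ≡⟨ List.length-++ (filter coprime-to-p^[1+k]? (map suc (upTo n))) ⟩
          coprimeCount n + length (filter coprime-to-p^[1+k]? [ suc n ])
        ∎
        where open ≡-Reasoning

      coprimeCount-within-block : ∀ q → coprimeCount (p * q) ≡ p′ * q → ∀ j → j ≤ p′ → coprimeCount (p * q + j) ≡ p′ * q + j
      coprimeCount-within-block q count≡ zero    _      =
        trans (cong coprimeCount (ℕ.+-identityʳ (p * q))) (trans count≡ (sym (ℕ.+-identityʳ (p′ * q))))
      coprimeCount-within-block q count≡ (suc j) 1+j≤p′ = begin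
          coprimeCount (p * q + suc j)
        ≡⟨ cong coprimeCount (ℕ.+-suc (p * q) j) ⟩
          coprimeCount (suc (p * q + j))
        ≡⟨ coprimeCount-suc (p * q + j) ⟩
          coprimeCount (p * q + j) + length (filter coprime-to-p^[1+k]? [ suc (p * q + j) ])
        ≡⟨ cong₂ _+_ (coprimeCount-within-block q count≡ j (ℕ.<⇒≤ 1+j≤p′))
                      (cong length (List.filter-accept coprime-to-p^[1+k]? (¬p∣⇒coprime-^ (suc k) p∤))) ⟩
          p′ * q + j + 1
        ≡⟨ trans (ℕ.+-assoc (p′ * q) j 1) (cong (p′ * q +_) (ℕ.+-comm j 1)) ⟩
          p′ * q + suc j
        ∎
        where
        open ≡-Reasoning
        p∤ : ¬ p ∣ suc (p * q + j)
        p∤ p∣ = ℕ.<⇒≱ (ℕ.s≤s 1+j≤p′) (∣⇒≤ (∣m+n∣m⇒∣n (subst (p ∣_) (sym (ℕ.+-suc (p * q) j)) p∣) (m∣m*n q)))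

      coprimeCount-blocks : ∀ q → coprimeCount (p * q) ≡ p′ * q
      coprimeCount-blocks zero    = trans (cong coprimeCount (ℕ.*-zeroʳ p)) (sym (ℕ.*-zeroʳ p′))
      coprimeCount-blocks (suc q) = begin
          coprimeCount (p * suc q)
        ≡⟨ cong coprimeCount (next-block p′ q) ⟩
          coprimeCount (suc (p * q + p′))
        ≡⟨ coprimeCount-suc (p * q + p′) ⟩
          coprimeCount (p * q + p′) + length (filter coprime-to-p^[1+k]? [ suc (p * q + p′) ])
        ≡⟨ cong₂ _+_ (coprimeCount-within-block q (coprimeCount-blocks q) p′ ℕ.≤-refl)
                      (cong length (List.filter-reject coprime-to-p^[1+k]?
                                      (p∣⇒¬coprime-^ k (subst (p ∣_) (next-block p′ q) (m∣m*n (suc q)))))) ⟩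
          p′ * q + p′ + 0
        ≡⟨ last-block p′ q ⟩
          p′ * suc q
        ∎
        where
        open ≡-Reasoning
        next-block : ∀ p′ q → suc p′ * suc q ≡ suc (suc p′ * q + p′)
        next-block = ℕ-Solver.solve-∀
        last-block : ∀ p′ q → p′ * q + p′ + 0 ≡ p′ * suc q
        last-block = ℕ-Solver.solve-∀

    φ[p^[1+k]]≡p′*p^k : ∀ k → φ (p ^ suc k) ≡ p′ * p ^ k
    φ[p^[1+k]]≡p′*p^k k = coprimeCount-blocks k (p ^ k)

module PowerExpansion where

  open Congruence
  open import Data.Nat.Base as ℕ using (ℕ; zero; suc)
  import Data.Nat.Properties as ℕ
  import Data.Nat.Tactic.RingSolver as ℕ-Solver
  open import Data.Integer.Base as ℤ using (ℤ; +_; 0ℤ; 1ℤ; _*_; _+_; _^_)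
  import Data.Integer.Properties as ℤ
  open import Data.Integer.Tactic.RingSolver using (solve-∀)
  open import Data.Product.Base using (∃; _,_)
  open import Function.Base using (_∘_)
  open import Relation.Binary.PropositionalEquality

  pow-1+-linear : ∀ {m d} w → d * d ≋ 0ℤ [mod m ] → (1ℤ + d) ^ w ≋ 1ℤ + + w * d [mod m ]
  pow-1+-linear         zero    d²≋0 = ≋-refl
  pow-1+-linear {m} {d} (suc w) d²≋0 = begin
      (1ℤ + d) * (1ℤ + d) ^ w              ≈⟨ *-congˡ≋ (1ℤ + d) (pow-1+-linear w d²≋0) ⟩
      (1ℤ + d) * (1ℤ + + w * d)            ≡⟨ expand (+ w) d ⟩
      1ℤ + (1ℤ + + w) * d + + w * (d * d)  ≈⟨ +-congˡ≋ (1ℤ + (1ℤ + + w) * d) (≋-trans (*-congˡ≋ (+ w) d²≋0) (≡⇒≋ (ℤ.*-zeroʳ (+ w)))) ⟩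
      1ℤ + (1ℤ + + w) * d + 0ℤ             ≡⟨ trans (ℤ.+-identityʳ _) (cong (λ n → 1ℤ + n * d) (sym (ℤ.pos-+ 1 w))) ⟩
      1ℤ + + suc w * d                     ∎
    where
    open ≋-Reasoning m
    expand : ∀ w d → (1ℤ + d) * (1ℤ + w * d) ≡ 1ℤ + (1ℤ + w) * d + w * (d * d)
    expand = solve-∀

  triangular : ℕ → ℕ
  triangular zero    = 0
  triangular (suc n) = triangular n ℕ.+ n

  triangular-odd : ∀ q → triangular (suc (q ℕ.+ q)) ≡ suc (q ℕ.+ q) ℕ.* q
  triangular-odd zero    = refl
  triangular-odd (suc q) = begin
      triangular (suc (suc q ℕ.+ suc q))
    ≡⟨ cong (triangular ∘ suc) (ℕ.+-suc (suc q) q) ⟩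
      triangular (suc (q ℕ.+ q)) ℕ.+ suc (q ℕ.+ q) ℕ.+ suc (suc (q ℕ.+ q))
    ≡⟨ cong (λ t → t ℕ.+ suc (q ℕ.+ q) ℕ.+ suc (suc (q ℕ.+ q))) (triangular-odd q) ⟩
      suc (q ℕ.+ q) ℕ.* q ℕ.+ suc (q ℕ.+ q) ℕ.+ suc (suc (q ℕ.+ q))
    ≡⟨ collect q ⟩
      suc (suc (suc (q ℕ.+ q))) ℕ.* suc q
    ≡⟨ cong (λ n → suc n ℕ.* suc q) (ℕ.+-suc (suc q) q) ⟨
      suc (suc q ℕ.+ suc q) ℕ.* suc q
    ∎
    where
    open ≡-Reasoning
    collect : ∀ q → suc (q ℕ.+ q) ℕ.* q ℕ.+ suc (q ℕ.+ q) ℕ.+ suc (suc (q ℕ.+ q)) ≡ suc (suc (suc (q ℕ.+ q))) ℕ.* suc q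
    collect = ℕ-Solver.solve-∀

  pow-1+-quadratic : ∀ d n → ∃ λ R → (1ℤ + d) ^ n ≡ 1ℤ + + n * d + + triangular n * (d * d) + R * (d * d * d)
  pow-1+-quadratic d zero    = 0ℤ , refl
  pow-1+-quadratic d (suc n) with R , eq ← pow-1+-quadratic d n =
    R + + triangular n + R * d , (begin
      (1ℤ + d) * (1ℤ + d) ^ n
    ≡⟨ cong ((1ℤ + d) *_) eq ⟩
      (1ℤ + d) * (1ℤ + + n * d + + triangular n * (d * d) + R * (d * d * d))
    ≡⟨ expand d (+ n) (+ triangular n) R ⟩
      1ℤ + (1ℤ + + n) * d + (+ triangular n + + n) * (d * d) + (R + + triangular n + R * d) * (d * d * d)
    ≡⟨ cong₂ (λ a b → 1ℤ + a * d + b * (d * d) + (R + + triangular n + R * d) * (d * d * d))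
             (sym (ℤ.pos-+ 1 n)) (sym (ℤ.pos-+ (triangular n) n)) ⟩
      1ℤ + + suc n * d + + triangular (suc n) * (d * d) + (R + + triangular n + R * d) * (d * d * d)
    ∎)
    where
    open ≡-Reasoning
    expand : ∀ d n t R → (1ℤ + d) * (1ℤ + n * d + t * (d * d) + R * (d * d * d))
                       ≡ 1ℤ + (1ℤ + n) * d + (t + n) * (d * d) + (R + t + R * d) * (d * d * d)
    expand = solve-∀

  -- This is where p = 2q + 1 must be odd: the second-order term needs p ∣ p(p − 1)/2.
  module _ (q : ℕ) where

    private
      p : ℕ
      p = suc (q ℕ.+ q)

    pow-p-1+p^[1+k]*c : ∀ k c →
      (1ℤ + + (p ℕ.^ suc k) * c) ^ p ≋ 1ℤ + + (p ℕ.^ (2 ℕ.+ k)) * c [mod p ℕ.^ (3 ℕ.+ k) ]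
    pow-p-1+p^[1+k]*c k c with R , eq ← pow-1+-quadratic (+ (p ℕ.^ suc k) * c) p = begin
        (1ℤ + + (p ℕ.^ suc k) * c) ^ p
      ≡⟨ eq ⟩
        1ℤ + + p * d + + triangular p * (d * d) + R * (d * d * d)
      ≡⟨ cong₂ (λ t d → 1ℤ + P * d + t * (d * d) + R * (d * d * d))
               (trans (cong +_ (triangular-odd q)) (ℤ.pos-* p q)) (cong (_* c) (ℤ.pos-* p (p ℕ.^ k))) ⟩
        1ℤ + P * (P * M * c) + P * Q * ((P * M * c) * (P * M * c)) + R * ((P * M * c) * (P * M * c) * (P * M * c))
      ≡⟨ regroup P M Q R c ⟩
        1ℤ + P * (P * M) * c + X * (P * (P * (P * M)))
      ≡⟨ cong₂ (λ a b → 1ℤ + a * c + X * b) (sym p^[2+k]≡) (sym (trans (ℤ.pos-* p _) (cong (P *_) p^[2+k]≡))) ⟩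
        1ℤ + + (p ℕ.^ (2 ℕ.+ k)) * c + X * + (p ℕ.^ (3 ℕ.+ k))
      ≈⟨ +-multiple≋ (1ℤ + + (p ℕ.^ (2 ℕ.+ k)) * c) X ⟩
        1ℤ + + (p ℕ.^ (2 ℕ.+ k)) * c
      ∎
      where
      open ≋-Reasoning (p ℕ.^ (3 ℕ.+ k))
      P Q M d X : ℤ
      P = + p
      Q = + q
      M = + (p ℕ.^ k)
      d = + (p ℕ.^ suc k) * c
      X = Q * M * c * c + R * M * M * c * c * c
      p^[2+k]≡ : + (p ℕ.^ (2 ℕ.+ k)) ≡ P * (P * M)
      p^[2+k]≡ = trans (ℤ.pos-* p _) (cong (P *_) (ℤ.pos-* p _))
      regroup : ∀ P M Q R c →
        1ℤ + P * (P * M * c) + P * Q * ((P * M * c) * (P * M * c)) + R * ((P * M * c) * (P * M * c) * (P * M * c))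
        ≡ 1ℤ + P * (P * M) * c + (Q * M * c * c + R * M * M * c * c * c) * (P * (P * (P * M)))
      regroup = solve-∀

    pow-p′*p^k : ∀ {z e} → z ^ (q ℕ.+ q) ≋ 1ℤ + + p * e [mod p ℕ.^ 2 ] →
                 ∀ k → z ^ ((q ℕ.+ q) ℕ.* p ℕ.^ k) ≋ 1ℤ + + (p ℕ.^ suc k) * e [mod p ℕ.^ (2 ℕ.+ k) ]
    pow-p′*p^k {z} {e} z^p′≋ zero = begin
        z ^ ((q ℕ.+ q) ℕ.* 1)   ≡⟨ cong (z ^_) (ℕ.*-identityʳ (q ℕ.+ q)) ⟩
        z ^ (q ℕ.+ q)           ≈⟨ z^p′≋ ⟩
        1ℤ + + p * e            ≡⟨ cong (λ n → 1ℤ + + n * e) (ℕ.*-identityʳ p) ⟨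
        1ℤ + + (p ℕ.^ 1) * e    ∎
      where open ≋-Reasoning (p ℕ.^ 2)
    pow-p′*p^k {z} {e} z^p′≋ (suc k) with ≋-by s eq ← pow-p′*p^k z^p′≋ k = begin
        z ^ ((q ℕ.+ q) ℕ.* p ℕ.^ suc k)
      ≡⟨ trans (cong (z ^_) (reassociate (q ℕ.+ q) p (p ℕ.^ k))) (sym (ℤ.^-*-assoc z ((q ℕ.+ q) ℕ.* p ℕ.^ k) p)) ⟩
        (z ^ ((q ℕ.+ q) ℕ.* p ℕ.^ k)) ^ p
      ≡⟨ cong (_^ p) (trans eq (trans (cong (λ n → 1ℤ + K * e + s * n) (ℤ.pos-* p (p ℕ.^ suc k))) (factor K e s (+ p)))) ⟩
        (1ℤ + K * (e + s * + p)) ^ p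
      ≈⟨ pow-p-1+p^[1+k]*c k (e + s * + p) ⟩
        1ℤ + K′ * (e + s * + p)
      ≡⟨ trans (cong (λ n → 1ℤ + K′ * e + s * n) (ℤ.pos-* p (p ℕ.^ (2 ℕ.+ k)))) (factor K′ e s (+ p)) ⟨
        1ℤ + K′ * e + s * + (p ℕ.^ (3 ℕ.+ k))
      ≈⟨ +-multiple≋ (1ℤ + K′ * e) s ⟩
        1ℤ + K′ * e
      ∎
      where
      open ≋-Reasoning (p ℕ.^ (3 ℕ.+ k))
      K K′ : ℤ
      K = + (p ℕ.^ suc k)
      K′ = + (p ℕ.^ (2 ℕ.+ k))
      reassociate : ∀ a p m → a ℕ.* (p ℕ.* m) ≡ a ℕ.* m ℕ.* p
      reassociate = ℕ-Solver.solve-∀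
      factor : ∀ K e s p → 1ℤ + K * e + s * (p * K) ≡ 1ℤ + K * (e + s * p)
      factor = solve-∀

module Determinant where

  open FinSum
  open import Data.Nat.Base as ℕ using (ℕ; zero; suc)
  import Data.Nat.Properties as ℕ
  open import Data.Integer.Base as ℤ using (ℤ; +_; -[1+_]; 0ℤ; 1ℤ; _*_; _+_; -_)
  import Data.Integer.Properties as ℤ
  open import Data.Integer.Tactic.RingSolver using (solve-∀)
  open import Data.Fin.Base as Fin using (Fin; zero; suc; toℕ; punchIn; punchOut; inject₁)
  import Data.Fin.Properties as Fin
  open import Data.Fin.Properties using (_≟_)
  open import Data.Fin.Permutation.Components using (transpose)
  open import Data.Vec.Functional using (updateAt)
  open import Data.Vec.Functional.Properties using (updateAt-updates; updateAt-minimal)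
  open import Data.Product.Base using (_×_; _,_)
  open import Data.Sum.Base using (_⊎_; inj₁; inj₂)
  open import Function.Base using (_∘_)
  open import Relation.Binary.Definitions using (tri<; tri≈; tri>)
  open import Relation.Binary.PropositionalEquality
  open import Relation.Nullary.Decidable using (yes; no)
  open import Relation.Nullary.Negation using (contradiction)

  Matrix : ℕ → Set
  Matrix n = Fin n → Fin n → ℤ

  minor : ∀ {n} → Matrix (suc n) → Fin (suc n) → Matrix n
  minor M j r c = M (suc r) (punchIn j c)

  expansionTerm : ∀ {n} → Matrix (suc n) → Fin (suc n) → ℤ
  expansionTerm {n} M j = sign (toℕ j) * M zero j * det n (minor M j)

  det-cong : ∀ n {M N : Matrix n} → (∀ r c → M r c ≡ N r c) → det n M ≡ det n N
  det-cong zero    M≡N = refl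
  det-cong (suc n) M≡N = sumFin-cong (suc n) λ j →
    cong₂ (λ a b → sign (toℕ j) * a * b) (M≡N zero j) (det-cong n (λ r c → M≡N (suc r) (punchIn j c)))

  punchIn-punchOut≢ : ∀ {n} {j c : Fin (suc n)} (j≢c : j ≢ c) {d} → d ≢ punchOut j≢c → punchIn j d ≢ c
  punchIn-punchOut≢ j≢c d≢c′ eq = d≢c′ (Fin.punchIn-injective _ _ _ (trans eq (sym (Fin.punchIn-punchOut j≢c))))

  det-linear-column : ∀ n (M A B : Matrix n) c x y →
    (∀ r d → d ≢ c → M r d ≡ A r d) → (∀ r d → d ≢ c → M r d ≡ B r d) →
    (∀ r → M r c ≡ x * A r c + y * B r c) → det n M ≡ x * det n A + y * det n B
  det-linear-column (suc n) M A B c x y M≡A M≡B column-c =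
    trans (sumFin-cong (suc n) term) (sumFin-linear (suc n) x y (expansionTerm A) (expansionTerm B))
    where
    term : ∀ j → expansionTerm M j ≡ x * expansionTerm A j + y * expansionTerm B j
    term j with j ≟ c
    ... | yes refl = begin
        sign (toℕ j) * M zero j * det n (minor M j)
      ≡⟨ cong₂ (λ a b → sign (toℕ j) * a * b) (column-c zero) minorM≡minorA ⟩
        sign (toℕ j) * (x * A zero j + y * B zero j) * det n (minor A j)
      ≡⟨ distribute (sign (toℕ j)) x y (A zero j) (B zero j) (det n (minor A j)) ⟩
        x * expansionTerm A j + y * (sign (toℕ j) * B zero j * det n (minor A j))
      ≡⟨ cong (λ D → x * expansionTerm A j + y * (sign (toℕ j) * B zero j * D)) (trans (sym minorM≡minorA) minorM≡minorB) ⟩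
        x * expansionTerm A j + y * expansionTerm B j
      ∎
      where
      open ≡-Reasoning
      minorM≡minorA : det n (minor M j) ≡ det n (minor A j)
      minorM≡minorA = det-cong n (λ r d → M≡A (suc r) (punchIn j d) (Fin.punchInᵢ≢i j d))
      minorM≡minorB : det n (minor M j) ≡ det n (minor B j)
      minorM≡minorB = det-cong n (λ r d → M≡B (suc r) (punchIn j d) (Fin.punchInᵢ≢i j d))
      distribute : ∀ s x y a b D → s * (x * a + y * b) * D ≡ x * (s * a * D) + y * (s * b * D)
      distribute = solve-∀
    ... | no j≢c = begin
        sign (toℕ j) * M zero j * det n (minor M j)
      ≡⟨ cong (sign (toℕ j) * M zero j *_) minor-linear ⟩
        sign (toℕ j) * M zero j * (x * det n (minor A j) + y * det n (minor B j))
      ≡⟨ distribute (sign (toℕ j)) x y (M zero j) (det n (minor A j)) (det n (minor B j)) ⟩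
        x * (sign (toℕ j) * M zero j * det n (minor A j)) + y * (sign (toℕ j) * M zero j * det n (minor B j))
      ≡⟨ cong₂ (λ a b → x * (sign (toℕ j) * a * det n (minor A j)) + y * (sign (toℕ j) * b * det n (minor B j)))
               (M≡A zero j j≢c) (M≡B zero j j≢c) ⟩
        x * expansionTerm A j + y * expansionTerm B j
      ∎
      where
      open ≡-Reasoning
      minor-linear : det n (minor M j) ≡ x * det n (minor A j) + y * det n (minor B j)
      minor-linear = det-linear-column n (minor M j) (minor A j) (minor B j) (punchOut j≢c) x y
        (λ r d d≢c′ → M≡A (suc r) (punchIn j d) (punchIn-punchOut≢ j≢c d≢c′))
        (λ r d d≢c′ → M≡B (suc r) (punchIn j d) (punchIn-punchOut≢ j≢c d≢c′))
        (λ r → subst (λ e → M (suc r) e ≡ x * A (suc r) e + y * B (suc r) e) (sym (Fin.punchIn-punchOut j≢c)) (column-c (suc r)))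
      distribute : ∀ s x y m DA DB → s * m * (x * DA + y * DB) ≡ x * (s * m * DA) + y * (s * m * DB)
      distribute = solve-∀

  punchIn-adjacent : ∀ {n} {c d : Fin (suc n)} → toℕ d ≡ suc (toℕ c) → ∀ k →
    (punchIn c k ≡ punchIn d k × punchIn c k ≢ c × punchIn c k ≢ d) ⊎ (punchIn c k ≡ d × punchIn d k ≡ c)
  punchIn-adjacent {c = zero}  {suc zero} _   zero    = inj₂ (refl , refl)
  punchIn-adjacent {c = zero}  {suc zero} _   (suc k) = inj₁ (refl , (λ ()) , (λ ()))
  punchIn-adjacent {c = suc c} {suc d}    _   zero    = inj₁ (refl , (λ ()) , (λ ()))
  punchIn-adjacent {c = suc c} {suc d}    adj (suc k) with punchIn-adjacent (ℕ.suc-injective adj) k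
  ... | inj₁ (eq , ≢c , ≢d) = inj₁ (cong suc eq , ≢c ∘ Fin.suc-injective , ≢d ∘ Fin.suc-injective)
  ... | inj₂ (eq₁ , eq₂)    = inj₂ (cong suc eq₁ , cong suc eq₂)

  punchOut-adjacent : ∀ {n} {j c d : Fin (suc n)} (j≢c : j ≢ c) (j≢d : j ≢ d) →
                      toℕ d ≡ suc (toℕ c) → toℕ (punchOut j≢d) ≡ suc (toℕ (punchOut j≢c))
  punchOut-adjacent {j = zero}                      {zero}  {_}        j≢c _   _   = contradiction refl j≢c
  punchOut-adjacent {j = zero}                      {suc c} {suc d}    _   _   adj = ℕ.suc-injective adj
  punchOut-adjacent {j = suc zero}                  {zero}  {suc zero} _   j≢d _   = contradiction refl j≢d
  punchOut-adjacent {suc (suc n)} {j = suc (suc j)} {zero}  {suc zero} _   _   _   = refl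
  punchOut-adjacent {suc n}       {j = suc j}       {suc c} {suc d}    j≢c j≢d adj =
    cong suc (punchOut-adjacent (j≢c ∘ cong suc) (j≢d ∘ cong suc) (ℕ.suc-injective adj))

  det-swap-adjacent : ∀ n (M N : Matrix n) {c d} → toℕ d ≡ suc (toℕ c) →
    (∀ r → N r c ≡ M r d) → (∀ r → N r d ≡ M r c) → (∀ r e → e ≢ c → e ≢ d → N r e ≡ M r e) →
    det n N ≡ - det n M
  det-swap-adjacent (suc n) M N {c} {d} adj Nc≡Md Nd≡Mc N≡M =
    sumFin-antisym (suc n) (expansionTerm N) (expansionTerm M) c≢d other-terms c-term d-term
    where
    c≢d : c ≢ d
    c≢d c≡d = ℕ.1+n≢n (sym (trans (cong toℕ c≡d) adj))
    s*m*D≡-[-s*m*D] : ∀ s m D → s * m * D ≡ - (- s * m * D)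
    s*m*D≡-[-s*m*D] = solve-∀
    s*m*[-D]≡-[s*m*D] : ∀ s m D → s * m * - D ≡ - (s * m * D)
    s*m*[-D]≡-[s*m*D] = solve-∀
    minor-c : ∀ r k → minor N c r k ≡ minor M d r k
    minor-c r k with punchIn-adjacent adj k
    ... | inj₁ (eq , ≢c , ≢d) = trans (N≡M (suc r) (punchIn c k) ≢c ≢d) (cong (M (suc r)) eq)
    ... | inj₂ (eq₁ , eq₂)    = trans (cong (N (suc r)) eq₁) (trans (Nd≡Mc (suc r)) (cong (M (suc r)) (sym eq₂)))
    minor-d : ∀ r k → minor N d r k ≡ minor M c r k
    minor-d r k with punchIn-adjacent adj k
    ... | inj₁ (eq , ≢c , ≢d) = trans (cong (N (suc r)) (sym eq)) (N≡M (suc r) (punchIn c k) ≢c ≢d)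
    ... | inj₂ (eq₁ , eq₂)    = trans (cong (N (suc r)) eq₂) (trans (Nc≡Md (suc r)) (cong (M (suc r)) (sym eq₁)))
    c-term : expansionTerm N c ≡ - expansionTerm M d
    c-term = begin
      sign (toℕ c) * N zero c * det n (minor N c)        ≡⟨ cong₂ (λ a D → sign (toℕ c) * a * D) (Nc≡Md zero) (det-cong n minor-c) ⟩
      sign (toℕ c) * M zero d * det n (minor M d)        ≡⟨ s*m*D≡-[-s*m*D] (sign (toℕ c)) (M zero d) (det n (minor M d)) ⟩
      - (- sign (toℕ c) * M zero d * det n (minor M d))  ≡⟨ cong (λ s → - (s * M zero d * det n (minor M d))) (cong sign adj) ⟨
      - expansionTerm M d                                ∎
      where open ≡-Reasoning
    d-term : expansionTerm N d ≡ - expansionTerm M c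
    d-term = begin
      sign (toℕ d) * N zero d * det n (minor N d)          ≡⟨ cong₂ (λ a D → sign (toℕ d) * a * D) (Nd≡Mc zero) (det-cong n minor-d) ⟩
      sign (toℕ d) * M zero c * det n (minor M c)          ≡⟨ cong (λ s → s * M zero c * det n (minor M c)) (cong sign adj) ⟩
      - sign (toℕ c) * M zero c * det n (minor M c)        ≡⟨ s*m*D≡-[-s*m*D] (- sign (toℕ c)) (M zero c) (det n (minor M c)) ⟩
      - (- - sign (toℕ c) * M zero c * det n (minor M c))  ≡⟨ cong (λ s → - (s * M zero c * det n (minor M c)))
                                                                  (ℤ.neg-involutive (sign (toℕ c))) ⟩
      - expansionTerm M c                                  ∎
      where open ≡-Reasoning
    other-terms : ∀ j → j ≢ c → j ≢ d → expansionTerm N j ≡ - expansionTerm M j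
    other-terms j j≢c j≢d = trans (cong₂ (λ a D → sign (toℕ j) * a * D) (N≡M zero j j≢c j≢d) minor-swapped)
                                  (s*m*[-D]≡-[s*m*D] (sign (toℕ j)) (M zero j) (det n (minor M j)))
      where
      minor-swapped : det n (minor N j) ≡ - det n (minor M j)
      minor-swapped = det-swap-adjacent n (minor M j) (minor N j) (punchOut-adjacent j≢c j≢d adj)
        (λ r → trans (cong (N (suc r)) (Fin.punchIn-punchOut j≢c))
                     (trans (Nc≡Md (suc r)) (cong (M (suc r)) (sym (Fin.punchIn-punchOut j≢d)))))
        (λ r → trans (cong (N (suc r)) (Fin.punchIn-punchOut j≢d))
                     (trans (Nd≡Mc (suc r)) (cong (M (suc r)) (sym (Fin.punchIn-punchOut j≢c)))))
        (λ r e e≢c′ e≢d′ → N≡M (suc r) (punchIn j e) (punchIn-punchOut≢ j≢c e≢c′) (punchIn-punchOut≢ j≢d e≢d′))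

  transpose-matchˡ : ∀ {n} (i j : Fin n) → transpose i j i ≡ j
  transpose-matchˡ i j with i ≟ i
  ... | yes _  = refl
  ... | no i≢i = contradiction refl i≢i

  transpose-matchʳ : ∀ {n} (i j : Fin n) → transpose i j j ≡ i
  transpose-matchʳ i j with j ≟ i
  ... | yes refl = refl
  ... | no _ with j ≟ j
  ...   | yes _  = refl
  ...   | no j≢j = contradiction refl j≢j

  transpose-mismatch : ∀ {n} {i j k : Fin n} → k ≢ i → k ≢ j → transpose i j k ≡ k
  transpose-mismatch {i = i} {j} {k} k≢i k≢j with k ≟ i
  ... | yes k≡i = contradiction k≡i k≢i
  ... | no _ with k ≟ j
  ...   | yes k≡j = contradiction k≡j k≢j
  ...   | no _    = refl

  i≡-i⇒i≡0 : ∀ {i} → i ≡ - i → i ≡ 0ℤ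
  i≡-i⇒i≡0 {+ zero}    _  = refl
  i≡-i⇒i≡0 {+ suc n}   ()
  i≡-i⇒i≡0 { -[1+ n ]} ()

  -- Swapping columns d − 1 and d flips the sign and brings the repeated column one step closer to column c.
  det-equal-columns-at-distance : ∀ g {n} (M : Matrix n) {c d} → toℕ d ≡ suc (g ℕ.+ toℕ c) →
                                   (∀ r → M r c ≡ M r d) → det n M ≡ 0ℤ
  det-equal-columns-at-distance zero    M adj Mc≡Md =
    i≡-i⇒i≡0 (det-swap-adjacent _ M M adj Mc≡Md (sym ∘ Mc≡Md) (λ _ _ _ _ → refl))
  det-equal-columns-at-distance (suc g) {suc n} M {c} {suc d₀} distance Mc≡Md =
    trans (sym (ℤ.neg-involutive (det (suc n) M))) (cong -_ (trans (sym swapped) N≡0))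
    where
    d⁻ d : Fin (suc n)
    d⁻ = inject₁ d₀
    d = suc d₀
    toℕ-d⁻ : toℕ d⁻ ≡ suc (g ℕ.+ toℕ c)
    toℕ-d⁻ = trans (Fin.toℕ-inject₁ d₀) (ℕ.suc-injective distance)
    c≢d⁻ : c ≢ d⁻
    c≢d⁻ c≡d⁻ = ℕ.m≢1+n+m (toℕ c) (trans (cong toℕ c≡d⁻) toℕ-d⁻)
    c≢d : c ≢ d
    c≢d c≡d = ℕ.m≢1+n+m (toℕ c) (trans (cong toℕ c≡d) distance)
    N : Matrix (suc n)
    N r e = M r (transpose d⁻ d e)
    swapped : det (suc n) N ≡ - det (suc n) M
    swapped = det-swap-adjacent (suc n) M N (cong suc (sym (Fin.toℕ-inject₁ d₀)))
      (λ r → cong (M r) (transpose-matchˡ d⁻ d))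
      (λ r → cong (M r) (transpose-matchʳ d⁻ d))
      (λ r e e≢d⁻ e≢d → cong (M r) (transpose-mismatch e≢d⁻ e≢d))
    N≡0 : det (suc n) N ≡ 0ℤ
    N≡0 = det-equal-columns-at-distance g N toℕ-d⁻ λ r →
      trans (cong (M r) (transpose-mismatch c≢d⁻ c≢d)) (trans (Mc≡Md r) (sym (cong (M r) (transpose-matchˡ d⁻ d))))

  m<n⇒n≡1+[n∸1+m]+m : ∀ {m n} → m ℕ.< n → n ≡ suc (n ℕ.∸ suc m ℕ.+ m)
  m<n⇒n≡1+[n∸1+m]+m {m} m<n = sym (trans (sym (ℕ.+-suc _ m)) (ℕ.m∸n+n≡m m<n))

  det-equal-columns : ∀ n (M : Matrix n) {c d} → c ≢ d → (∀ r → M r c ≡ M r d) → det n M ≡ 0ℤ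
  det-equal-columns n M {c} {d} c≢d Mc≡Md with ℕ.<-cmp (toℕ c) (toℕ d)
  ... | tri< c<d _ _ = det-equal-columns-at-distance _ M (m<n⇒n≡1+[n∸1+m]+m c<d) Mc≡Md
  ... | tri≈ _ c≡d _ = contradiction (Fin.toℕ-injective c≡d) c≢d
  ... | tri> _ _ d<c = det-equal-columns-at-distance _ M (m<n⇒n≡1+[n∸1+m]+m d<c) (sym ∘ Mc≡Md)

  replaceColumn : ∀ {n} → Matrix n → Fin n → (Fin n → ℤ) → Matrix n
  replaceColumn M c v r = updateAt (M r) c (λ _ → v r)

  replaceColumn-same : ∀ {n} (M : Matrix n) c v r → replaceColumn M c v r c ≡ v r
  replaceColumn-same M c v r = updateAt-updates c (M r)

  replaceColumn-other : ∀ {n} (M : Matrix n) {c} v r {d} → d ≢ c → replaceColumn M c v r d ≡ M r d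
  replaceColumn-other M {c} v r {d} d≢c = updateAt-minimal d c (M r) d≢c

  replaceColumn-self : ∀ {n} (M : Matrix n) c r d → replaceColumn M c (λ r → M r c) r d ≡ M r d
  replaceColumn-self M c r d with d ≟ c
  ... | yes refl = replaceColumn-same M c (λ r → M r c) r
  ... | no d≢c   = replaceColumn-other M (λ r → M r c) r d≢c

  det-replaceColumn-sumFin : ∀ n (M : Matrix n) c m (w : Fin m → ℤ) (v : Fin m → Fin n → ℤ) →
    det n (replaceColumn M c (λ r → sumFin m (λ e → w e * v e r))) ≡ sumFin m (λ e → w e * det n (replaceColumn M c (v e)))
  det-replaceColumn-sumFin n M c zero w v =
    det-linear-column n _ M M c 0ℤ 0ℤ (λ r d → replaceColumn-other M zeros r) (λ r d → replaceColumn-other M zeros r)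
                      (replaceColumn-same M c zeros)
    where
    zeros : Fin n → ℤ
    zeros _ = 0ℤ
  det-replaceColumn-sumFin n M c (suc m) w v =
    trans (det-linear-column n _ (replaceColumn M c (v zero)) (replaceColumn M c rest) c (w zero) 1ℤ
            (λ r d d≢c → trans (replaceColumn-other M sum r d≢c) (sym (replaceColumn-other M (v zero) r d≢c)))
            (λ r d d≢c → trans (replaceColumn-other M sum r d≢c) (sym (replaceColumn-other M rest r d≢c)))
            (λ r → trans (replaceColumn-same M c sum r)
                         (sym (cong₂ (λ a b → w zero * a + b) (replaceColumn-same M c (v zero) r)
                                                             (trans (ℤ.*-identityˡ _) (replaceColumn-same M c rest r))))))
          (cong (_+_ (w zero * det n (replaceColumn M c (v zero))))
                (trans (ℤ.*-identityˡ _) (det-replaceColumn-sumFin n M c m (w ∘ suc) (v ∘ suc))))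
    where
    sum rest : Fin n → ℤ
    sum r = sumFin (suc m) (λ e → w e * v e r)
    rest r = sumFin m (λ e → w (suc e) * v (suc e) r)

  cramer : ∀ n (M : Matrix n) (z : Fin n → ℤ) c →
    det n (replaceColumn M c (λ r → sumFin n (λ e → z e * M r e))) ≡ z c * det n M
  cramer n M z c = begin
      det n (replaceColumn M c (λ r → sumFin n (λ e → z e * M r e)))
    ≡⟨ det-replaceColumn-sumFin n M c n z column ⟩
      sumFin n (λ e → z e * det n (replaceColumn M c (column e)))
    ≡⟨ sumFin-single n _ c (λ e e≢c → trans (cong (z e *_) (equal-columns e≢c)) (ℤ.*-zeroʳ (z e))) ⟩
      z c * det n (replaceColumn M c (column c))
    ≡⟨ cong (z c *_) (det-cong n (replaceColumn-self M c)) ⟩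
      z c * det n M
    ∎
    where
    open ≡-Reasoning
    column : Fin n → Fin n → ℤ
    column e r = M r e
    equal-columns : ∀ {e} → e ≢ c → det n (replaceColumn M c (column e)) ≡ 0ℤ
    equal-columns {e} e≢c = det-equal-columns n _ (e≢c ∘ sym)
      (λ r → trans (replaceColumn-same M c (column e) r) (sym (replaceColumn-other M (column e) r e≢c)))

module DeterminantModPrime where

  open Congruence
  open FinSum
  open Determinant
  open import Data.Nat.Base as ℕ using (ℕ; zero; suc; NonZero)
  import Data.Nat.Properties as ℕ
  open import Data.Nat.Primality using (Prime; prime⇒nonZero)
  open import Data.Integer.Base as ℤ using (ℤ; +_; 0ℤ; 1ℤ; -1ℤ; _-_; _*_; _+_)
  import Data.Integer.Properties as ℤ
  import Data.Integer.DivMod as ℤ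
  open import Data.Integer.Tactic.RingSolver using (solve-∀)
  open import Data.Fin.Base as Fin using (Fin; zero; suc; toℕ; punchOut; finToFun; funToFin; combine)
  import Data.Fin.Properties as Fin
  open import Data.Product.Base using (∃; _,_)
  open import Data.Sum.Base using ([_,_]′)
  open import Function.Base using (_∘_)
  open import Function.Definitions using (Injective)
  open import Relation.Binary.PropositionalEquality
  open import Relation.Nullary.Decidable using (yes; no)
  open import Relation.Nullary.Negation using (¬_; contradiction)

  det-column≋0 : ∀ n (M : Matrix n) c {m} → (∀ r → M r c ≋ 0ℤ [mod m ]) → det n M ≋ 0ℤ [mod m ]
  det-column≋0 n M c {m} column≋0 = ≋-by (det n A) (trans
    (det-linear-column n M A A c (+ m) 0ℤ
      (λ r d d≢c → sym (replaceColumn-other M q r d≢c)) (λ r d d≢c → sym (replaceColumn-other M q r d≢c))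
      (λ r → trans (_≋_[mod_].equation (column≋0 r))
                   (trans (0+q*m≡m*q+0*q (q r) (+ m)) (cong (λ a → + m * a + 0ℤ * a) (sym (replaceColumn-same M c q r))))))
    (m*D+0*D≡0+D*m (det n A) (+ m)))
    where
    q : Fin n → ℤ
    q r = _≋_[mod_].quotient (column≋0 r)
    A : Matrix n
    A = replaceColumn M c q
    0+q*m≡m*q+0*q : ∀ q m → 0ℤ + q * m ≡ m * q + 0ℤ * q
    0+q*m≡m*q+0*q = solve-∀
    m*D+0*D≡0+D*m : ∀ D m → m * D + 0ℤ * D ≡ 0ℤ + D * m
    m*D+0*D≡0+D*m = solve-∀

  Fin-injective⇒surjective : ∀ {N} (f : Fin N → Fin N) → Injective _≡_ _≡_ f → ∀ y → ∃ λ x → f x ≡ y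
  Fin-injective⇒surjective {suc N} f f-injective y with Fin.any? (λ x → f x Fin.≟ y)
  ... | yes hit = hit
  ... | no miss = contradiction (Fin.injective⇒≤ punchOut∘f-injective) ℕ.1+n≰n
    where
    y≢f : ∀ x → y ≢ f x
    y≢f x y≡fx = miss (x , sym y≡fx)
    punchOut∘f-injective : Injective _≡_ _≡_ (λ x → punchOut (y≢f x))
    punchOut∘f-injective eq = f-injective (Fin.punchOut-injective (y≢f _) (y≢f _) eq)

  funToFin-cong : ∀ {m n} {f g : Fin m → Fin n} → (∀ i → f i ≡ g i) → funToFin f ≡ funToFin g
  funToFin-cong {zero}  f≗g = refl
  funToFin-cong {suc m} f≗g = cong₂ combine (f≗g zero) (funToFin-cong (f≗g ∘ suc))

  funToFin-injective : ∀ {m n} {f g : Fin m → Fin n} → funToFin f ≡ funToFin g → ∀ i → f i ≡ g i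
  funToFin-injective {f = f} {g} eq i =
    trans (sym (Fin.finToFun-funToFin f i)) (trans (cong (λ k → finToFun k i) eq) (Fin.finToFun-funToFin g i))

  module _ {p} (p-prime : Prime p) where

    private
      instance
        p≢0 : NonZero p
        p≢0 = prime⇒nonZero p-prime

    det≉0⇒kernel-trivial : ∀ n (M : Matrix n) → ¬ det n M ≋ 0ℤ [mod p ] → (z : Fin n → ℤ) →
                            (∀ r → sumFin n (λ e → M r e * z e) ≋ 0ℤ [mod p ]) → ∀ c → z c ≋ 0ℤ [mod p ]
    det≉0⇒kernel-trivial n M det≉0 z Mz≋0 c =
      [ (λ zc≋0 → zc≋0) , (λ det≋0 → contradiction det≋0 det≉0) ]′ (euclidsLemma≋ p-prime (z c) (det n M) zc*det≋0)
      where
      Mz : Fin n → ℤ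
      Mz r = sumFin n (λ e → z e * M r e)
      zc*det≋0 : z c * det n M ≋ 0ℤ [mod p ]
      zc*det≋0 = ≋-trans (≡⇒≋ (sym (cramer n M z c))) (det-column≋0 n (replaceColumn M c Mz) c λ r →
        ≋-trans (≡⇒≋ (trans (replaceColumn-same M c Mz r) (sumFin-cong n (λ e → ℤ.*-comm (z e) (M r e))))) (Mz≋0 r))

    det≉0⇒injective : ∀ n (M : Matrix n) → ¬ det n M ≋ 0ℤ [mod p ] → (z z′ : Fin n → ℤ) →
                       (∀ r → sumFin n (λ e → M r e * z e) ≋ sumFin n (λ e → M r e * z′ e) [mod p ]) →
                       ∀ c → z c ≋ z′ c [mod p ]
    det≉0⇒injective n M det≉0 z z′ Mz≋Mz′ c =
      -≋0⇒≋ (det≉0⇒kernel-trivial n M det≉0 (λ e → z e - z′ e) (λ r → ≋-trans (≡⇒≋ (linear r)) (≋⇒-≋0 (Mz≋Mz′ r))) c)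
      where
      m*[a-b]≡1*[m*a]+-1*[m*b] : ∀ m a b → m * (a - b) ≡ 1ℤ * (m * a) + -1ℤ * (m * b)
      m*[a-b]≡1*[m*a]+-1*[m*b] = solve-∀
      1*a+-1*b≡a-b : ∀ a b → 1ℤ * a + -1ℤ * b ≡ a - b
      1*a+-1*b≡a-b = solve-∀
      linear : ∀ r → sumFin n (λ e → M r e * (z e - z′ e)) ≡ sumFin n (λ e → M r e * z e) - sumFin n (λ e → M r e * z′ e)
      linear r = trans (sumFin-cong n (λ e → m*[a-b]≡1*[m*a]+-1*[m*b] (M r e) (z e) (z′ e)))
                       (trans (sumFin-linear n 1ℤ -1ℤ (λ e → M r e * z e) (λ e → M r e * z′ e))
                              (1*a+-1*b≡a-b (sumFin n (λ e → M r e * z e)) (sumFin n (λ e → M r e * z′ e))))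

    residue : ℤ → Fin p
    residue a = Fin.fromℕ< (ℤ.n%ℕd<d a p)

    ≋-residue : ∀ a → a ≋ + toℕ (residue a) [mod p ]
    ≋-residue a = ≋-trans (≋-%ℕ a) (≡⇒≋ (cong +_ (sym (Fin.toℕ-fromℕ< (ℤ.n%ℕd<d a p)))))

    -- Vectors of residues (ℤ/p)ⁿ are coded as Fin (p ^ n); an injective self-map of a finite set is onto.
    det≉0⇒surjective : ∀ n (M : Matrix n) → ¬ det n M ≋ 0ℤ [mod p ] → (b : Fin n → ℤ) →
                        ∃ λ (z : Fin n → Fin p) → ∀ r → sumFin n (λ e → M r e * + toℕ (z e)) ≋ b r [mod p ]
    det≉0⇒surjective n M det≉0 b = solution (Fin-injective⇒surjective G G-injective (funToFin (residue ∘ b)))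
      where
      Mz : (Fin n → Fin p) → Fin n → ℤ
      Mz z r = sumFin n (λ e → M r e * + toℕ (z e))
      G : Fin (p ℕ.^ n) → Fin (p ℕ.^ n)
      G i = funToFin (residue ∘ Mz (finToFun i))
      same-residue : ∀ {a b} → residue a ≡ residue b → a ≋ b [mod p ]
      same-residue {a} {b} eq = ≋-trans (≋-residue a) (≋-trans (≡⇒≋ (cong (+_ ∘ toℕ) eq)) (≋-sym (≋-residue b)))
      G-injective : Injective _≡_ _≡_ G
      G-injective {i} {j} Gi≡Gj =
        trans (sym (Fin.funToFin-finToFin {n} {p} i)) (trans (funToFin-cong same-digits) (Fin.funToFin-finToFin {n} {p} j))
        where
        digits≋ : ∀ e → + toℕ (finToFun i e) ≋ + toℕ (finToFun j e) [mod p ]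
        digits≋ = det≉0⇒injective n M det≉0 (+_ ∘ toℕ ∘ finToFun i) (+_ ∘ toℕ ∘ finToFun j)
                                  (λ r → same-residue (funToFin-injective Gi≡Gj r))
        same-digits : ∀ e → finToFun i e ≡ finToFun j e
        same-digits e = Fin.toℕ-injective (≋-nat-injective (Fin.toℕ<n _) (Fin.toℕ<n _) (digits≋ e))
      solution : (∃ λ i → G i ≡ funToFin (residue ∘ b)) → ∃ λ (z : Fin n → Fin p) → ∀ r → Mz z r ≋ b r [mod p ]
      solution (i , Gi≡b) = finToFun i , λ r → same-residue (funToFin-injective Gi≡b r)

module Lifting where

  open Congruence
  open FinSum
  open Fermat
  open Totient
  open PowerExpansion
  open Determinant
  open DeterminantModPrime
  open import Data.Nat.Base as ℕ using (ℕ; zero; suc; _≤_)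
  import Data.Nat.Properties as ℕ
  import Data.Nat.Divisibility as ℕ
  import Data.Nat.DivMod as ℕ
  import Data.Nat.Tactic.RingSolver as ℕ-Solver
  open import Data.Nat.Primality using (Prime; prime⇒irreducible)
  open import Data.Integer.Base as ℤ using (ℤ; +_; 0ℤ; 1ℤ; _*_; _+_; _^_)
  import Data.Integer.Properties as ℤ
  open import Data.Integer.Tactic.RingSolver using (solve-∀)
  open import Data.Fin.Base as Fin using (Fin; toℕ; _↑ˡ_; _↑ʳ_; splitAt)
  import Data.Fin.Properties as Fin
  open import Data.Product.Base using (∃; _×_; _,_; proj₁; proj₂)
  open import Data.Sum.Base using (inj₁; inj₂)
  open import Data.Sum.Properties using ([,]-∘)
  open import Data.Vec.Functional using (_++_)
  open import Data.Vec.Functional.Properties using (lookup-++ˡ; lookup-++ʳ)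
  open import Function.Base using (_∘_)
  open import Relation.Binary.PropositionalEquality
  open import Relation.Nullary.Negation using (¬_; contradiction)

  prime≢2⇒odd : ∀ {p} → Prime p → p ≢ 2 → ∃ λ q → p ≡ suc (q ℕ.+ q)
  prime≢2⇒odd {p} p-prime p≢2 with p ℕ.% 2 | ℕ.m≡m%n+[m/n]*n p 2 | ℕ.m%n<n p 2
  ... | 0 | p≡[p/2]*2 | _ with prime⇒irreducible p-prime (ℕ.divides (p ℕ./ 2) p≡[p/2]*2)
  ...   | inj₁ ()
  ...   | inj₂ 2≡p = contradiction (sym 2≡p) p≢2
  prime≢2⇒odd {p} p-prime p≢2 | 1 | p≡1+[p/2]*2 | _ =
    p ℕ./ 2 , trans p≡1+[p/2]*2 (cong suc (trans (ℕ.*-comm (p ℕ./ 2) 2) (cong (p ℕ./ 2 ℕ.+_) (ℕ.+-identityʳ (p ℕ./ 2)))))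
  prime≢2⇒odd {p} p-prime p≢2 | suc (suc _) | _ | ℕ.s≤s (ℕ.s≤s ())

  Zp-coherent : ∀ {p} (a : Zp p) {m} → 1 ≤ m → ∀ d → seq a (m ℕ.+ d) ≋ seq a m [mod p ℕ.^ m ]
  Zp-coherent a {m} 1≤m zero = ≡⇒≋ (cong (seq a) (ℕ.+-identityʳ m))
  Zp-coherent {p} a {m} 1≤m (suc d) = ≋-trans
    (≋-weaken (subst (p ℕ.^ m ℕ.∣_) (sym (ℕ.^-distribˡ-+-* p m d)) (ℕ.m∣m*n (p ℕ.^ d)))
              (≡[mod]⇒≋ (subst (λ e → seq a e ≡ seq a (m ℕ.+ d) [mod p ℕ.^ (m ℕ.+ d) ]) (sym (ℕ.+-suc m d))
                               (coh a (m ℕ.+ d) (ℕ.≤-trans 1≤m (ℕ.m≤m+n m d))))))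
    (Zp-coherent a 1≤m d)

  ++-split : ∀ {m k} {A : Set} (f : Fin (m ℕ.+ k) → A) c → ((f ∘ (_↑ˡ k)) ++ (f ∘ (m ↑ʳ_))) c ≡ f c
  ++-split {m} {k} f c = trans (sym ([,]-∘ f (splitAt m c))) (cong f (Fin.join-splitAt m k c))

  module HenselLifting
    (q : ℕ) (p-prime : Prime (suc (q ℕ.+ q)))
    (t : ℕ) (a₁ : Fin t → ℤ) (α₁ : Fin t → ℕ) (x y : Fin (t ℕ.+ t) → Zp (suc (q ℕ.+ q)))
    (x-unit : ∀ i → IsUnit (x i))
    (det≉0 : ¬ det (t ℕ.+ t) (matrix2p5 (suc (q ℕ.+ q)) t a₁ α₁ x) ≋ 0ℤ [mod suc (q ℕ.+ q) ])
    (fits-mod-p : ∀ i → evalCoord t (λ j → constZp (a₁ j)) (λ j → constEp (α₁ j)) (x i) 1 ≡ seq (y i) 1 [mod suc (q ℕ.+ q) ])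
    where

    p p′ n : ℕ
    p = suc (q ℕ.+ q)
    p′ = q ℕ.+ q
    n = t ℕ.+ t

    M : Matrix n
    M = matrix2p5 p t a₁ α₁ x

    X Y : Fin n → ℕ → ℤ
    X i = seq (x i)
    Y i = seq (y i)

    E : Fin n → ℤ
    E i = e₂ p (X i 2)

    X-coherent : ∀ i k → X i (suc k) ≋ X i 1 [mod p ]
    X-coherent i k = ≋-modulus (ℕ.*-identityʳ p) (Zp-coherent (x i) (ℕ.s≤s ℕ.z≤n) k)

    X-unit : ∀ i k → ¬ X i (suc k) ≋ 0ℤ [mod p ]
    X-unit i k X≋0 = x-unit i (≋0⇒∣ (≋-trans (≋-sym (X-coherent i k)) X≋0))

    X-power : ∀ i k j {B} → + B ≋ + α₁ j [mod p′ ] → X i (suc k) ^ B ≋ X i 1 ^ α₁ j [mod p ]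
    X-power i k j B≋α = ≋-trans (fermat-exponent p-prime (X-unit i k) B≋α) (^-cong≋ (α₁ j) (X-coherent i k))

    X-totient-power : ∀ i k → X i (2 ℕ.+ k) ^ (p′ ℕ.* p ℕ.^ k) ≋ 1ℤ + + (p ℕ.^ suc k) * E i [mod p ℕ.^ (2 ℕ.+ k) ]
    X-totient-power i k =
      pow-p′*p^k q (≋-trans (^-cong≋ p′ (Zp-coherent (x i) (ℕ.s≤s ℕ.z≤n) k)) (≡⇒≋ (e₂-spec p-prime (X-unit i 1)))) k

    M-left : ∀ i j → M i (j ↑ˡ t) ≡ X i 1 ^ α₁ j
    M-left i j rewrite Fin.splitAt-↑ˡ t j t = refl

    M-right : ∀ i j → M i (t ↑ʳ j) ≡ a₁ j * E i * X i 1 ^ α₁ j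
    M-right i j rewrite Fin.splitAt-↑ʳ t t j = refl

    linearPart : Fin n → (Fin t → ℤ) → (Fin t → ℕ) → ℤ
    linearPart i u w = sumFin n (λ c → M i c * (u ++ (+_ ∘ w)) c)

    linearPart-split : ∀ i u w → linearPart i u w ≡ sumFin t (λ j → M i (j ↑ˡ t) * u j + M i (t ↑ʳ j) * + w j)
    linearPart-split i u w = begin
        sumFin n (λ c → M i c * v c)
      ≡⟨ sumFin-++ t t (λ c → M i c * v c) ⟩
        sumFin t (λ j → M i (j ↑ˡ t) * v (j ↑ˡ t)) + sumFin t (λ j → M i (t ↑ʳ j) * v (t ↑ʳ j))
      ≡⟨ cong₂ _+_ (sumFin-cong t (λ j → cong (M i (j ↑ˡ t) *_) (lookup-++ˡ u (+_ ∘ w) j)))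
                   (sumFin-cong t (λ j → cong (M i (t ↑ʳ j) *_) (lookup-++ʳ u (+_ ∘ w) j))) ⟩
        sumFin t (λ j → M i (j ↑ˡ t) * u j) + sumFin t (λ j → M i (t ↑ʳ j) * + w j)
      ≡⟨ sumFin-+ t (λ j → M i (j ↑ˡ t) * u j) (λ j → M i (t ↑ʳ j) * + w j) ⟨
        sumFin t (λ j → M i (j ↑ˡ t) * u j + M i (t ↑ʳ j) * + w j)
      ∎
      where
      open ≡-Reasoning
      v : Fin n → ℤ
      v = u ++ (+_ ∘ w)

    -- The index is shifted: Solves k holds modulo p ^ (k + 1), at coordinate k + 1.
    Solves : ℕ → (Fin t → ℤ) → (Fin t → ℕ) → Set
    Solves k A B = ∀ i → sumFin t (λ j → A j * X i (suc k) ^ B j) ≋ Y i (suc k) [mod p ℕ.^ suc k ]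

    Solves-cong : ∀ {k A A′ B B′} → (∀ j → A j ≡ A′ j) → (∀ j → B j ≡ B′ j) → Solves k A B → Solves k A′ B′
    Solves-cong {k} A≡A′ B≡B′ solves i =
      ≋-trans (≡⇒≋ (sumFin-cong t (λ j → cong₂ (λ a e → a * X i (suc k) ^ e) (sym (A≡A′ j)) (sym (B≡B′ j))))) (solves i)

    record Approximation (k : ℕ) : Set where
      field
        coeff    : Fin t → ℤ
        expo     : Fin t → ℕ
        coeff≋a₁ : ∀ j → coeff j ≋ a₁ j [mod p ]
        expo≋α₁  : ∀ j → + expo j ≋ + α₁ j [mod p′ ]
        solves   : Solves k coeff expo
    open Approximation

    module _ (k : ℕ) where

      private
        K : ℤ
        K = + (p ℕ.^ suc k)
        N : ℕ
        N = p′ ℕ.* p ℕ.^ k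

      K*K≋0 : K * K ≋ 0ℤ [mod p ℕ.^ (2 ℕ.+ k) ]
      K*K≋0 = ≋-by (+ (p ℕ.^ k)) (trans (sym (ℤ.pos-* (p ℕ.^ suc k) (p ℕ.^ suc k)))
                                         (trans (cong +_ (square p (p ℕ.^ k)))
                                                (trans (ℤ.pos-* (p ℕ.^ k) (p ℕ.^ (2 ℕ.+ k))) (sym (ℤ.+-identityˡ _)))))
        where
        square : ∀ p m → p ℕ.* m ℕ.* (p ℕ.* m) ≡ m ℕ.* (p ℕ.* (p ℕ.* m))
        square = ℕ-Solver.solve-∀

      term-linear : ∀ i j {A B} → A ≋ a₁ j [mod p ] → + B ≋ + α₁ j [mod p′ ] → ∀ u w →
        (A + K * u) * X i (2 ℕ.+ k) ^ (B ℕ.+ N ℕ.* w) ≋ A * X i (2 ℕ.+ k) ^ B + K * (M i (j ↑ˡ t) * u + M i (t ↑ʳ j) * + w)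
          [mod p ℕ.^ (2 ℕ.+ k) ]
      term-linear i j {A} {B} A≋a B≋α u w = begin
          (A + K * u) * Z ^ (B ℕ.+ N ℕ.* w)
        ≡⟨ cong ((A + K * u) *_) (trans (ℤ.^-distribˡ-+-* Z B (N ℕ.* w)) (cong (Z ^ B *_) (sym (ℤ.^-*-assoc Z N w)))) ⟩
          (A + K * u) * (Z ^ B * (Z ^ N) ^ w)
        ≈⟨ *-congˡ≋ (A + K * u) (*-congˡ≋ (Z ^ B) (≋-trans (^-cong≋ w (X-totient-power i k)) (pow-1+-linear w KE*KE≋0))) ⟩
          (A + K * u) * (Z ^ B * (1ℤ + + w * (K * E i)))
        ≡⟨ expand A K u (Z ^ B) (+ w) (E i) ⟩
          A * Z ^ B + K * (Z ^ B * u + A * E i * Z ^ B * + w) + u * Z ^ B * + w * E i * (K * K)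
        ≈⟨ +-congˡ≋ (A * Z ^ B + K * (Z ^ B * u + A * E i * Z ^ B * + w)) (multiple-of-K*K (u * Z ^ B * + w * E i)) ⟩
          A * Z ^ B + K * (Z ^ B * u + A * E i * Z ^ B * + w) + 0ℤ
        ≡⟨ ℤ.+-identityʳ _ ⟩
          A * Z ^ B + K * (Z ^ B * u + A * E i * Z ^ B * + w)
        ≈⟨ +-congˡ≋ (A * Z ^ B) (*-scale≋ (p ℕ.^ suc k) linear-coefficients) ⟩
          A * Z ^ B + K * (M i (j ↑ˡ t) * u + M i (t ↑ʳ j) * + w)
        ∎
        where
        open ≋-Reasoning (p ℕ.^ (2 ℕ.+ k))
        Z : ℤ
        Z = X i (2 ℕ.+ k)
        multiple-of-K*K : ∀ c → c * (K * K) ≋ 0ℤ [mod p ℕ.^ (2 ℕ.+ k) ]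
        multiple-of-K*K c = ≋-trans (*-congˡ≋ c K*K≋0) (≡⇒≋ (ℤ.*-zeroʳ c))
        KE*KE≋0 : K * E i * (K * E i) ≋ 0ℤ [mod p ℕ.^ (2 ℕ.+ k) ]
        KE*KE≋0 = ≋-trans (≡⇒≋ (regroup K (E i))) (multiple-of-K*K (E i * E i))
          where
          regroup : ∀ K E → K * E * (K * E) ≡ E * E * (K * K)
          regroup = solve-∀
        expand : ∀ A K u ZB w E → (A + K * u) * (ZB * (1ℤ + w * (K * E)))
                                 ≡ A * ZB + K * (ZB * u + A * E * ZB * w) + u * ZB * w * E * (K * K)
        expand = solve-∀
        linear-coefficients : Z ^ B * u + A * E i * Z ^ B * + w ≋ M i (j ↑ˡ t) * u + M i (t ↑ʳ j) * + w [mod p ]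
        linear-coefficients = +-cong≋
          (*-congʳ≋ u (≋-trans (X-power i (suc k) j B≋α) (≡⇒≋ (sym (M-left i j)))))
          (*-congʳ≋ (+ w) (≋-trans (*-cong≋ (*-congʳ≋ (E i) A≋a) (X-power i (suc k) j B≋α)) (≡⇒≋ (sym (M-right i j)))))

      linearization : ∀ i {A : Fin t → ℤ} {B : Fin t → ℕ} → (∀ j → A j ≋ a₁ j [mod p ]) → (∀ j → + B j ≋ + α₁ j [mod p′ ]) →
        ∀ u w → sumFin t (λ j → (A j + K * u j) * X i (2 ℕ.+ k) ^ (B j ℕ.+ N ℕ.* w j))
                  ≋ sumFin t (λ j → A j * X i (2 ℕ.+ k) ^ B j) + K * linearPart i u w [mod p ℕ.^ (2 ℕ.+ k) ]
      linearization i {A} {B} A≋a B≋α u w = begin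
          sumFin t (λ j → (A j + K * u j) * Z ^ (B j ℕ.+ N ℕ.* w j))
        ≈⟨ sumFin-cong≋ t (λ j → term-linear i j {A j} {B j} (A≋a j) (B≋α j) (u j) (w j)) ⟩
          sumFin t (λ j → A j * Z ^ B j + K * L j)
        ≡⟨ sumFin-+ t (λ j → A j * Z ^ B j) (λ j → K * L j) ⟩
          sumFin t (λ j → A j * Z ^ B j) + sumFin t (λ j → K * L j)
        ≡⟨ cong (_+_ (sumFin t (λ j → A j * Z ^ B j)))
                (trans (sym (*-distribˡ-sumFin t K L)) (cong (K *_) (sym (linearPart-split i u w)))) ⟩
          sumFin t (λ j → A j * Z ^ B j) + K * linearPart i u w
        ∎
        where
        open ≋-Reasoning (p ℕ.^ (2 ℕ.+ k))
        Z : ℤ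
        Z = X i (2 ℕ.+ k)
        L : Fin t → ℤ
        L j = M i (j ↑ˡ t) * u j + M i (t ↑ʳ j) * + w j

      next-coordinate≋ : (L : Approximation k) → ∀ i →
        Y i (2 ℕ.+ k) ≋ sumFin t (λ j → coeff L j * X i (2 ℕ.+ k) ^ expo L j) [mod p ℕ.^ suc k ]
      next-coordinate≋ L i = begin
          Y i (2 ℕ.+ k)                                        ≈⟨ ≡[mod]⇒≋ (coh (y i) (suc k) (ℕ.s≤s ℕ.z≤n)) ⟩
          Y i (suc k)                                          ≈⟨ solves L i ⟨
          sumFin t (λ j → coeff L j * X i (suc k) ^ expo L j)  ≈⟨ sumFin-cong≋ t (λ j → *-congˡ≋ (coeff L j) (^-cong≋ (expo L j) X≋)) ⟨
          sumFin t (λ j → coeff L j * X i (2 ℕ.+ k) ^ expo L j) ∎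
        where
        open ≋-Reasoning (p ℕ.^ suc k)
        X≋ : X i (2 ℕ.+ k) ≋ X i (suc k) [mod p ℕ.^ suc k ]
        X≋ = ≡[mod]⇒≋ (coh (x i) (suc k) (ℕ.s≤s ℕ.z≤n))

      refine : (L : Approximation k) → ∃ λ (L′ : Approximation (suc k)) →
                 (∀ j → coeff L′ j ≋ coeff L j [mod p ℕ.^ suc k ]) × (∀ j → + expo L′ j ≋ + expo L j [mod N ])
      refine L = record
        { coeff    = A′
        ; expo     = B′
        ; coeff≋a₁ = λ j → ≋-trans (≋-weaken (ℕ.m∣m*n (p ℕ.^ k)) (A′≋A j)) (coeff≋a₁ L j)
        ; expo≋α₁  = λ j → ≋-trans (≋-weaken (ℕ.m∣m*n (p ℕ.^ k)) (B′≋B j)) (expo≋α₁ L j)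
        ; solves   = solves′
        } , A′≋A , B′≋B
        where
        S : Fin n → ℤ
        S i = sumFin t (λ j → coeff L j * X i (2 ℕ.+ k) ^ expo L j)
        r : Fin n → ℤ
        r i = _≋_[mod_].quotient (next-coordinate≋ L i)
        correction : ∃ λ (z : Fin n → Fin p) → ∀ i → sumFin n (λ c → M i c * + toℕ (z c)) ≋ r i [mod p ]
        correction = det≉0⇒surjective p-prime n M det≉0 r
        z : Fin n → Fin p
        z = proj₁ correction
        u : Fin t → ℤ
        u j = + toℕ (z (j ↑ˡ t))
        w : Fin t → ℕ
        w j = toℕ (z (t ↑ʳ j))
        A′ : Fin t → ℤ
        A′ j = coeff L j + K * u j
        B′ : Fin t → ℕ
        B′ j = expo L j ℕ.+ N ℕ.* w j
        A′≋A : ∀ j → A′ j ≋ coeff L j [mod p ℕ.^ suc k ]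
        A′≋A j = ≋-by (u j) (cong (_+_ (coeff L j)) (ℤ.*-comm K (u j)))
        B′≋B : ∀ j → + B′ j ≋ + expo L j [mod N ]
        B′≋B j = +-multipleℕ≋ (expo L j) N (w j)
        linearPart≋r : ∀ i → linearPart i u w ≋ r i [mod p ]
        linearPart≋r i = ≋-trans (≡⇒≋ (sumFin-cong n (λ c → cong (M i c *_) (++-split {t} {t} (+_ ∘ toℕ ∘ z) c))))
                                 (proj₂ correction i)
        solves′ : Solves (suc k) A′ B′
        solves′ i = begin
            sumFin t (λ j → A′ j * X i (2 ℕ.+ k) ^ B′ j)  ≈⟨ linearization i (coeff≋a₁ L) (expo≋α₁ L) u w ⟩
            S i + K * linearPart i u w                    ≈⟨ +-congˡ≋ (S i) (*-scale≋ (p ℕ.^ suc k) (linearPart≋r i)) ⟩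
            S i + K * r i                                 ≡⟨ trans (cong (_+_ (S i)) (ℤ.*-comm K (r i)))
                                                                   (sym (_≋_[mod_].equation (next-coordinate≋ L i))) ⟩
            Y i (2 ℕ.+ k)                                 ∎
          where open ≋-Reasoning (p ℕ.^ (2 ℕ.+ k))

      linear-unique : ∀ {A : Fin t → ℤ} {b : Fin t → ℕ} → (∀ j → A j ≋ a₁ j [mod p ]) → (∀ j → + b j ≋ + α₁ j [mod p′ ]) →
        ∀ u u′ w w′ → Solves (suc k) (λ j → A j + K * u j) (λ j → b j ℕ.+ N ℕ.* w j) →
                      Solves (suc k) (λ j → A j + K * u′ j) (λ j → b j ℕ.+ N ℕ.* w′ j) →
        (∀ j → u j ≋ u′ j [mod p ]) × (∀ j → + w j ≋ + w′ j [mod p ])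
      linear-unique {A} {b} A≋a b≋α u u′ w w′ solves-uw solves-uw′ =
        (λ j → subst₂ (_≋_[mod p ]) (lookup-++ˡ u (+_ ∘ w) j) (lookup-++ˡ u′ (+_ ∘ w′) j) (same-correction (j ↑ˡ t))) ,
        (λ j → subst₂ (_≋_[mod p ]) (lookup-++ʳ u (+_ ∘ w) j) (lookup-++ʳ u′ (+_ ∘ w′) j) (same-correction (t ↑ʳ j)))
        where
        S : Fin n → ℤ
        S i = sumFin t (λ j → A j * X i (2 ℕ.+ k) ^ b j)
        same-linearPart : ∀ i → linearPart i u w ≋ linearPart i u′ w′ [mod p ]
        same-linearPart i = *-cancel-scale≋ (p ℕ.^ suc k) {{ℕ.m^n≢0 p (suc k)}} (≋-cancelˡ (S i) (begin
            S i + K * linearPart i u w                                              ≈⟨ linearization i A≋a b≋α u w ⟨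
            sumFin t (λ j → (A j + K * u j) * X i (2 ℕ.+ k) ^ (b j ℕ.+ N ℕ.* w j))    ≈⟨ solves-uw i ⟩
            Y i (2 ℕ.+ k)                                                           ≈⟨ solves-uw′ i ⟨
            sumFin t (λ j → (A j + K * u′ j) * X i (2 ℕ.+ k) ^ (b j ℕ.+ N ℕ.* w′ j))  ≈⟨ linearization i A≋a b≋α u′ w′ ⟩
            S i + K * linearPart i u′ w′                                            ∎))
          where open ≋-Reasoning (p ℕ.^ (2 ℕ.+ k))
        same-correction : ∀ c → (u ++ (+_ ∘ w)) c ≋ (u′ ++ (+_ ∘ w′)) c [mod p ]
        same-correction = det≉0⇒injective p-prime n M det≉0 (u ++ (+_ ∘ w)) (u′ ++ (+_ ∘ w′)) same-linearPart

      approximation-unique : (L : Approximation (suc k)) (A′ : Fin t → ℤ) (B′ : Fin t → ℕ) → Solves (suc k) A′ B′ →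
        (∀ j → A′ j ≋ coeff L j [mod p ℕ.^ suc k ]) → (∀ j → + B′ j ≋ + expo L j [mod N ]) →
        (∀ j → A′ j ≋ coeff L j [mod p ℕ.^ (2 ℕ.+ k) ]) × (∀ j → + B′ j ≋ + expo L j [mod p′ ℕ.* p ℕ.^ suc k ])
      approximation-unique L A′ B′ solves′ A′≋A B′≋B = A′≋A-finer , B′≋B-finer
        where
        u : Fin t → ℤ
        u j = _≋_[mod_].quotient (A′≋A j)
        A′≡ : ∀ j → coeff L j + K * u j ≡ A′ j
        A′≡ j = sym (trans (_≋_[mod_].equation (A′≋A j)) (cong (_+_ (coeff L j)) (ℤ.*-comm (u j) K)))
        A≡ : ∀ j → coeff L j + K * 0ℤ ≡ coeff L j
        A≡ j = trans (cong (_+_ (coeff L j)) (ℤ.*-zeroʳ K)) (ℤ.+-identityʳ (coeff L j))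
        base : ∀ j → CommonBase (B′ j) (expo L j) N
        base j = ≋-nat-common-base (B′≋B j)
        b w′ w : Fin t → ℕ
        b j = CommonBase.base (base j)
        w′ j = CommonBase.stepsˡ (base j)
        w j = CommonBase.stepsʳ (base j)
        b≋α : ∀ j → + b j ≋ + α₁ j [mod p′ ]
        b≋α j = ≋-trans (≋-weaken (ℕ.m∣m*n (p ℕ.^ k)) (base≋ʳ (base j))) (expo≋α₁ L j)
        unique : (∀ j → 0ℤ ≋ u j [mod p ]) × (∀ j → + w j ≋ + w′ j [mod p ])
        unique = linear-unique (coeff≋a₁ L) b≋α (λ _ → 0ℤ) u w w′
          (Solves-cong (sym ∘ A≡) (CommonBase.eqʳ ∘ base) (solves L))
          (Solves-cong (sym ∘ A′≡) (CommonBase.eqˡ ∘ base) solves′)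
        A′≋A-finer : ∀ j → A′ j ≋ coeff L j [mod p ℕ.^ (2 ℕ.+ k) ]
        A′≋A-finer j = ≋-refine (A′≋A j) (≋-sym (proj₁ unique j))
        B′≋B-finer : ∀ j → + B′ j ≋ + expo L j [mod p′ ℕ.* p ℕ.^ suc k ]
        B′≋B-finer j = ≋-modulus (reassociate p p′ (p ℕ.^ k)) (begin
            + B′ j                  ≡⟨ cong +_ (CommonBase.eqˡ (base j)) ⟩
            + (b j ℕ.+ N ℕ.* w′ j)  ≈⟨ +-*-scaleℕ≋ (b j) N (≋-sym (proj₂ unique j)) ⟩
            + (b j ℕ.+ N ℕ.* w j)   ≡⟨ cong +_ (CommonBase.eqʳ (base j)) ⟨
            + expo L j              ∎)
          where
          open ≋-Reasoning (p ℕ.* N)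
          reassociate : ∀ p p′ m → p ℕ.* (p′ ℕ.* m) ≡ p′ ℕ.* (p ℕ.* m)
          reassociate = ℕ-Solver.solve-∀

    initial : Approximation 0
    initial = record
      { coeff    = a₁
      ; expo     = α₁
      ; coeff≋a₁ = λ _ → ≋-refl
      ; expo≋α₁  = λ _ → ≋-refl
      ; solves   = λ i → ≋-modulus (sym (ℕ.*-identityʳ p)) (≡[mod]⇒≋ (fits-mod-p i))
      }

    level : ∀ k → Approximation k
    level zero    = initial
    level (suc k) = proj₁ (refine k (level k))

    φ[p^[1+k]]≡N : ∀ k → φ (p ℕ.^ suc k) ≡ p′ ℕ.* p ℕ.^ k
    φ[p^[1+k]]≡N = φ[p^[1+k]]≡p′*p^k p-prime

    -- Coordinate k ≥ 1 is read off the approximation modulo p ^ k; coordinate 0 is never inspected.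
    coefficient : Fin t → Zp p
    coefficient j = mkZp (λ k → coeff (level (ℕ.pred k)) j) coherent
      where
      coherent : ∀ k → 1 ≤ k → coeff (level k) j ≡ coeff (level (ℕ.pred k)) j [mod p ℕ.^ k ]
      coherent (suc k) _ = ≋⇒≡[mod] (proj₁ (proj₂ (refine k (level k))) j)

    exponent : Fin t → Ep p
    exponent j = mkEp (λ k → expo (level (ℕ.pred k)) j) coherent
      where
      coherent : ∀ k → 1 ≤ k → (+ expo (level k) j) ≡ (+ expo (level (ℕ.pred k)) j) [mod φ (p ℕ.^ k) ]
      coherent (suc k) _ = ≋⇒≡[mod] (≋-modulus (sym (φ[p^[1+k]]≡N k)) (proj₂ (proj₂ (refine k (level k))) j))

    coefficient-unit : ∀ j → IsUnit (coefficient j)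
    coefficient-unit j p∣a₁ = det≉0 (det-column≋0 n M (t ↑ʳ j) λ i → begin
        M i (t ↑ʳ j)                  ≡⟨ trans (M-right i j) (ℤ.*-assoc (a₁ j) (E i) (X i 1 ^ α₁ j)) ⟩
        a₁ j * (E i * X i 1 ^ α₁ j)  ≈⟨ *-congʳ≋ (E i * X i 1 ^ α₁ j) (∣⇒≋0 {a₁ j} p∣a₁) ⟩
        0ℤ * (E i * X i 1 ^ α₁ j)    ≡⟨ ℤ.*-zeroˡ (E i * X i 1 ^ α₁ j) ⟩
        0ℤ                           ∎)
      where open ≋-Reasoning p

    coefficient₁ : ∀ j → seq (coefficient j) 1 ≡ a₁ j [mod p ]
    coefficient₁ j = ≋⇒≡[mod] (≋-refl {a = a₁ j})

    exponent₁ : ∀ j → (+ eseq (exponent j) 1) ≡ (+ α₁ j) [mod φ p ]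
    exponent₁ j = ≋⇒≡[mod] (≋-refl {a = + α₁ j})

    solution : ∀ i → EvalEq t coefficient exponent (x i) (y i)
    solution i (suc k) _ = ≋⇒≡[mod] (solves (level k) i)

    module _ (a′ : Fin t → Zp p) (α′ : Fin t → Ep p) (solution′ : ∀ i → EvalEq t a′ α′ (x i) (y i))
             (a′₁ : ∀ j → seq (a′ j) 1 ≡ a₁ j [mod p ])
             (α′₁ : ∀ j → (+ eseq (α′ j) 1) ≡ (+ α₁ j) [mod φ p ])
             where

      agreement : ∀ k → (∀ j → seq (a′ j) (suc k) ≋ coeff (level k) j [mod p ℕ.^ suc k ]) ×
                        (∀ j → + eseq (α′ j) (suc k) ≋ + expo (level k) j [mod p′ ℕ.* p ℕ.^ k ])
      agreement zero =
        (λ j → ≋-modulus (sym (ℕ.*-identityʳ p)) (≡[mod]⇒≋ (a′₁ j))) ,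
        (λ j → ≋-modulus (trans (cong φ (sym (ℕ.*-identityʳ p))) (φ[p^[1+k]]≡N 0)) (≡[mod]⇒≋ (α′₁ j)))
      agreement (suc k) = approximation-unique k (level (suc k)) A′ B′ solves′ A′≋A B′≋B
        where
        A′ : Fin t → ℤ
        A′ j = seq (a′ j) (2 ℕ.+ k)
        B′ : Fin t → ℕ
        B′ j = eseq (α′ j) (2 ℕ.+ k)
        solves′ : Solves (suc k) A′ B′
        solves′ i = ≡[mod]⇒≋ (solution′ i (2 ℕ.+ k) (ℕ.s≤s ℕ.z≤n))
        A′≋A : ∀ j → A′ j ≋ coeff (level (suc k)) j [mod p ℕ.^ suc k ]
        A′≋A j = ≋-trans (≡[mod]⇒≋ (coh (a′ j) (suc k) (ℕ.s≤s ℕ.z≤n)))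
                         (≋-trans (proj₁ (agreement k) j) (≋-sym (proj₁ (proj₂ (refine k (level k))) j)))
        B′≋B : ∀ j → + B′ j ≋ + expo (level (suc k)) j [mod p′ ℕ.* p ℕ.^ k ]
        B′≋B j = ≋-trans (≋-modulus (φ[p^[1+k]]≡N k) (≡[mod]⇒≋ (ecoh (α′ j) (suc k) (ℕ.s≤s ℕ.z≤n))))
                         (≋-trans (proj₂ (agreement k) j) (≋-sym (proj₂ (proj₂ (refine k (level k))) j)))

      unique : (∀ j → a′ j ≈Zp coefficient j) × (∀ j → α′ j ≈Ep exponent j)
      unique = (λ { j (suc k) _ → ≋⇒≡[mod] (proj₁ (agreement k) j) }) ,
               (λ { j (suc k) _ → ≋⇒≡[mod] (≋-modulus (sym (φ[p^[1+k]]≡N k)) (proj₂ (agreement k) j)) })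

open import Data.Nat using (ℕ; _≤_; _∸_; _+_)
open import Relation.Binary.PropositionalEquality using (_≢_; refl)
open import Data.Nat.Primality using (Prime)
open import Data.Integer using (ℤ; +_)
open import Data.Integer.Divisibility using (_∣_)
open import Data.Fin using (Fin)
open import Data.Product using (Σ; _×_; _,_)
open import Relation.Nullary using (¬_)
open import Function.Base using (_∘_)
open Congruence using (≋0⇒∣)
open Lifting using (prime≢2⇒odd; module HenselLifting)

theorem2p5 : (p : ℕ) → Prime p → p ≢ 2 → (t : ℕ) → 1 ≤ t → t ≤ p ∸ 1
    → (y : Fin (t + t) → Zp p)
    → (a₁ : Fin t → ℤ) (α₁ : Fin t → ℕ)
    → (x : Fin (t + t) → Zp p) → (∀ i → IsUnit (x i))
    → (∀ i → evalCoord t (λ j → constZp (a₁ j)) (λ j → constEp (α₁ j)) (x i) 1 ≡ seq (y i) 1 [mod p ])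
    → ¬ ((+ p) ∣ det (t + t) (matrix2p5 p t a₁ α₁ x))
    → Σ (Fin t → Zp p) λ a → Σ (Fin t → Ep p) λ α →
        (((∀ j → IsUnit (a j)) × (∀ i → EvalEq t a α (x i) (y i))
          × (∀ j → seq (a j) 1 ≡ a₁ j [mod p ]) × (∀ j → (+ eseq (α j) 1) ≡ (+ α₁ j) [mod φ p ]))
        × ((a' : Fin t → Zp p) (α' : Fin t → Ep p)
           → (∀ j → IsUnit (a' j)) → (∀ i → EvalEq t a' α' (x i) (y i))
           → (∀ j → seq (a' j) 1 ≡ a₁ j [mod p ]) → (∀ j → (+ eseq (α' j) 1) ≡ (+ α₁ j) [mod φ p ])
           → (∀ j → a' j ≈Zp a j) × (∀ j → α' j ≈Ep α j)))
theorem2p5 p p-prime p≢2 t _ _ y a₁ α₁ x x-unit fits-mod-p p∤det with prime≢2⇒odd p-prime p≢2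
... | q , refl =
  coefficient , exponent ,
  (coefficient-unit , solution , coefficient₁ , exponent₁) ,
  (λ a′ α′ _ → unique a′ α′)
  where open HenselLifting q p-prime t a₁ α₁ x y x-unit (p∤det ∘ ≋0⇒∣) fits-mod-p
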